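{- Let $L$ be an integral $\mathbb{Z}$-lattice on a quadratic space $(V,Q)$ over $\mathbb{Q}$, $p$ an odd prime, $k\in\mathbb{N}$, and $j,r\in\mathbb{N}_0$. Let $\bm u\in L_p$ be primitive with $Q(\bm u)\in p^j\mathbb{Z}_p^\times$. If either $j=0$, or $L_p$ is unimodular and $j\in\mathbb{N}$, then \[\left[O(L_p):O\left(L_p+\tfrac{\bm u}{p^k}\right)\right]\ \ge\ \left|R\left(Q;\bm u,p^{k+j}\right)\big/\!\sim_k\right|.\] In particular, $\left[O(L_p):O\left(L_p+\tfrac{\bm u}{p^k}\right)\right]\ge r\left(Q;\bm u,p^k\right)$.
   Context: $L_p=L\otimes\mathbb{Z}_p\subset V_p=V\otimes\mathbb{Q}_p$; $B(\bm x,\bm y)=Q(\bm x+\bm y)-Q(\bm x)-Q(\bm y)$; $L$ integral means $\tfrac12 B(L,L)\subseteq\mathbb{Z}$; $L_p$ unimodular means the Gram matrix $(\tfrac12B(\bm e_i,\bm e_j))$ of a basis has unit determinant in $\mathbb{Z}_p$. $\bm u$ primitive means $\bm u\notin pL_p$. $O(L_p)$ is the group of isometries $\sigma$ of $V_p$ with $\sigma(L_p)=L_p$, and $O(L_p+\bm w)$ those with $\sigma(L_p+\bm w)=L_p+\bm w$ (a subgroup of $O(L_p)$). For $n\in\mathbb{N}$, $R(Q;\bm u,p^n)=\{\bm x\in L_p/p^nL_p: \bm x\notin pL_p,\ Q(\bm x)\equiv Q(\bm u)\pmod{p^n}\}$ and $r(Q;\bm u,p^n)=\#R(Q;\bm u,p^n)$.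 The relation $\bm x\sim_k\bm y$ means $\bm x-\bm y\in p^kL_p$. -}

module Defs where

open import Data.Nat using (ℕ; zero; suc)
open import Data.Integer using (ℤ; +_; _+_; _-_; _*_; -_; _^_; 0ℤ; 1ℤ)
open import Data.Integer.Divisibility using (_∣_)
open import Data.Fin using (Fin; zero; suc; punchIn)
open import Data.Product using (Σ; _×_)
open import Relation.Nullary using (¬_)
open import Relation.Binary.PropositionalEquality using (_≡_; _≢_)

sumFin : ∀ {n} → (Fin n → ℤ) → ℤ
sumFin {zero}  f = 0ℤ
sumFin {suc n} f = f zero + sumFin (λ i → f (suc i))

-- Integer matrices; the lattice L is ℤⁿ with Gram matrix A = (½B(eᵢ,eⱼ))
Mat : ℕ → Set
Mat n = Fin n → Fin n → ℤ

Symmetric : ∀ {n} → Mat n → Set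
Symmetric A = ∀ i j → A i j ≡ A j i

-- ½ B(x , y) for integer vectors
bil : ∀ {n} → Mat n → (Fin n → ℤ) → (Fin n → ℤ) → ℤ
bil A x y = sumFin (λ i → sumFin (λ j → A i j * x i * y j))

-- the quadratic space V = ℚⁿ is regular (nondegenerate): radical is zero
-- (tested on integer vectors, which suffices by clearing denominators)
Regular : ∀ {n} → Mat n → Set
Regular A = ∀ x → (∀ y → bil A x y ≡ 0ℤ) → ∀ i → x i ≡ 0ℤ

altSign : ℕ → ℤ
altSign zero = 1ℤ
altSign (suc m) = - altSign m

toℕ' : ∀ {n} → Fin n → ℕ
toℕ' zero = zero
toℕ' (suc i) = suc (toℕ' i)

det : ∀ {n} → Mat n → ℤ
det {zero}  M = 1ℤ
det {suc n} M =
  sumFin (λ j → altSign (toℕ' j) * M zero j * det (λ i l → M (suc i) (punchIn j l)))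

-- p-adic integers ℤ_p as compatible sequences: x m is a representative
-- of the residue class of x modulo p^m.
module PAdic (p : ℕ) where

  P : ℤ
  P = + p

  Seq : Set
  Seq = ℕ → ℤ

  IsZp : Seq → Set
  IsZp x = ∀ m → (P ^ m) ∣ (x (suc m) - x m)

  _≡[_]_ : Seq → ℕ → Seq → Set
  x ≡[ m ] y = (P ^ m) ∣ (x m - y m)

  _≈_ : Seq → Seq → Set
  x ≈ y = ∀ m → x ≡[ m ] y

  IsUnit : Seq → Set
  IsUnit x = ¬ (P ∣ x 1)

  ι : ℤ → Seq
  ι a m = a

  _⊕_ : Seq → Seq → Seq
  (x ⊕ y) m = x m + y m

  _⊗_ : Seq → Seq → Seq
  (x ⊗ y) m = x m * y m

  ΣS : ∀ {n} → (Fin n → Seq) → Seq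
  ΣS f m = sumFin (λ i → f i m)

  Vp : ℕ → Set
  Vp n = Fin n → Seq

  Mp : ℕ → Set
  Mp n = Fin n → Fin n → Seq

  IsZpVec : ∀ {n} → Vp n → Set
  IsZpVec x = ∀ i → IsZp (x i)

  IsZpMat : ∀ {n} → Mp n → Set
  IsZpMat g = ∀ i j → IsZp (g i j)

  ιv : ∀ {n} → (Fin n → ℤ) → Vp n
  ιv x i = ι (x i)

  Qp : ∀ {n} → Mat n → Vp n → Seq
  Qp A x = ΣS (λ i → ΣS (λ j → (ι (A i j) ⊗ x i) ⊗ x j))

  _·v_ : ∀ {n} → Mp n → Vp n → Vp n
  (g ·v x) i = ΣS (λ j → g i j ⊗ x j)

  _·m_ : ∀ {n} → Mp n → Mp n → Mp n
  (g ·m h) i l = ΣS (λ j → g i j ⊗ h j l)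

  Id : ∀ {n} → Mp n
  Id i j with i Data.Fin.≟ j
  ... | Relation.Nullary.yes _ = ι 1ℤ
  ... | Relation.Nullary.no _  = ι 0ℤ

  _≈m_ : ∀ {n} → Mp n → Mp n → Set
  g ≈m h = ∀ i j → g i j ≈ h i j

  InPL : ∀ {n} → Vp n → Set
  InPL x = ∀ i → P ∣ x i 1

  Primitive : ∀ {n} → Vp n → Set
  Primitive x = ¬ InPL x

  -- σ ∈ O(L_p): an isometry of V_p with σ(L_p) = L_p, i.e. a matrix over
  -- ℤ_p with inverse over ℤ_p, preserving Q.
  record InO {n} (A : Mat n) (g : Mp n) : Set where
    field
      integral    : IsZpMat g
      inv         : Mp n
      inv-integral : IsZpMat inv
      rinv        : (g ·m inv) ≈m Id
      linv        : (inv ·m g) ≈m Id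
      isometry    : ∀ x → IsZpVec x → Qp A (g ·v x) ≈ Qp A x

  -- σ ∈ O(L_p + u/p^k) (for σ ∈ O(L_p)):  σ(u/p^k) - u/p^k ∈ L_p,
  -- i.e. σ u ≡ u (mod p^k L_p)
  InStab : ∀ {n} → ℕ → Vp n → Mp n → Set
  InStab k u g = ∀ i → (g ·v u) i ≡[ k ] u i

  -- [O(L_p) : O(L_p + u/p^k)] ≥ N : there are N elements of O(L_p)
  -- lying in pairwise distinct left cosets of O(L_p + u/p^k)
  IndexAtLeast : ∀ {n} → Mat n → ℕ → Vp n → ℕ → Set
  IndexAtLeast A k u N =
    Σ (Fin N → Mp _) λ gs →
    Σ (∀ a → InO A (gs a)) λ isO →
      ∀ a b → a ≢ b → ¬ InStab k u (InO.inv (isO a) ·m gs b)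

  -- x ∈ R(Q; u, p^m), for x ∈ L_p / p^m L_p represented by an integer vector
  InR : ∀ {n} → Mat n → Vp n → ℕ → (Fin n → ℤ) → Set
  InR A u m x = Primitive (ιv x) × (Qp A (ιv x) ≡[ m ] Qp A u)

  Sim : ∀ {n} → ℕ → (Fin n → ℤ) → (Fin n → ℤ) → Set
  Sim k x y = ∀ i → (P ^ k) ∣ (x i - y i)

-- Write U for u modulo p^k. If σ and τ lie in one coset of O(L_p + u/p^k) then σU ≡ τU
-- (mod p^k), so the index is at least the number of classes x (mod p^k) of primitive vectors
-- with Q x ≡ Q U (mod p^k) that are reached as σU for some σ ∈ O(L_p); we show that all of
-- them are. The σ are products of at most two (signed) reflections in vectors v with Q v a
-- p-adic unit, built over ℤ_p from Newton approximations of 1/Q v. If Q U is a unit, then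
-- Q(U + x) + Q(U − x) ≡ 4 Q U shows that one of U ± x is anisotropic, and its reflection moves
-- U to x. If det A is a unit and p ∣ Q U, then either B(U, x) is a unit and U + x is
-- anisotropic, or, since the form is nondegenerate modulo p (Cramer's rule) and p is odd,
-- there is w with Q w, B(U, w), B(x, w) all units, and the reflection in w⊥ moves U to a
-- vector y for which y + x is anisotropic.

module Submission where

open import Defs

module _ where

  open import Data.Empty using (⊥-elim)
  open import Data.Fin as Fin using (Fin; zero; suc; punchIn; punchOut; inject₁; toℕ)
  import Data.Fin.Properties as Fin
  open import Data.Integer as ℤ using (ℤ; +_; _+_; _-_; _*_; -_; 0ℤ; 1ℤ; -1ℤ; _^_; ∣_∣)
  import Data.Integer.Properties as ℤ
  open import Algebra.Properties.Semiring.Sum ℤ.+-*-semiring using (sum; ∑-distrib-+; ∑-comm)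
  import Data.Integer.Divisibility as Unsigned
  open import Data.Integer.Divisibility.Signed
  open import Data.Integer.Tactic.RingSolver using (solve-∀)
  open import Data.Nat as ℕ using (ℕ; zero; suc)
  import Data.Nat.Properties as ℕ
  import Data.Nat.Divisibility as ℕ
  open import Data.Nat.Coprimality using (Coprime; coprime-Bézout)
  open import Data.Nat.GCD using (module Bézout)
  open import Data.Nat.Primality using (Prime; prime⇒irreducible; euclidsLemma; ¬prime[1]; prime[2])
  open import Data.Product using (Σ; _,_; proj₁; proj₂; _×_)
  open import Data.Sum using (_⊎_; inj₁; inj₂)
  open import Data.Vec.Functional using (Vector)
  open import Function using (_∘_)
  open import Relation.Binary.Bundles using (Setoid)
  open import Relation.Binary.Definitions using (tri<; tri≈; tri>)
  open import Relation.Binary.PropositionalEquality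
  open import Relation.Binary.Structures using (IsEquivalence)
  open import Relation.Nullary using (¬_; Dec; yes; no; contradiction)

  -- Congruences

  infix 4 _≡_mod_

  record _≡_mod_ (a b d : ℤ) : Set where
    constructor ≡-mod
    field ∣-diff : d ∣ a - b

  open _≡_mod_ public

  module _ {d : ℤ} where

    ≡⇒≡-mod : ∀ {a b} → a ≡ b → a ≡ b mod d
    ≡⇒≡-mod {a} refl = ≡-mod (divides 0ℤ (trans (ℤ.+-inverseʳ a) (sym (ℤ.*-zeroˡ d))))

    ≡-mod-refl : ∀ {a} → a ≡ a mod d
    ≡-mod-refl = ≡⇒≡-mod refl

    ≡-mod-sym : ∀ {a b} → a ≡ b mod d → b ≡ a mod d
    ≡-mod-sym {a} {b} (≡-mod d∣a-b) =
      ≡-mod (subst (d ∣_) (neg-diff a b) (∣m⇒∣-m d∣a-b))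
      where
        neg-diff : ∀ a b → - (a - b) ≡ b - a
        neg-diff = solve-∀

    ≡-mod-trans : ∀ {a b c} → a ≡ b mod d → b ≡ c mod d → a ≡ c mod d
    ≡-mod-trans {a} {b} {c} (≡-mod d∣a-b) (≡-mod d∣b-c) =
      ≡-mod (subst (d ∣_) (telescope a b c) (∣m∣n⇒∣m+n d∣a-b d∣b-c))
      where
        telescope : ∀ a b c → (a - b) + (b - c) ≡ a - c
        telescope = solve-∀

    ≡-mod-isEquivalence : IsEquivalence (λ a b → a ≡ b mod d)
    ≡-mod-isEquivalence = record
      { refl = ≡-mod-refl ; sym = ≡-mod-sym ; trans = ≡-mod-trans }

    +-cong-mod : ∀ {a b a′ b′} → a ≡ b mod d → a′ ≡ b′ mod d →
                 a + a′ ≡ b + b′ mod d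
    +-cong-mod {a} {b} {a′} {b′} (≡-mod d∣a-b) (≡-mod d∣a′-b′) =
      ≡-mod (subst (d ∣_) (regroup a b a′ b′) (∣m∣n⇒∣m+n d∣a-b d∣a′-b′))
      where
        regroup : ∀ a b a′ b′ → (a - b) + (a′ - b′) ≡ (a + a′) - (b + b′)
        regroup = solve-∀

    neg-cong-mod : ∀ {a b} → a ≡ b mod d → - a ≡ - b mod d
    neg-cong-mod {a} {b} (≡-mod d∣a-b) =
      ≡-mod (subst (d ∣_) (regroup a b) (∣m⇒∣-m d∣a-b))
      where
        regroup : ∀ a b → - (a - b) ≡ (- a) - (- b)
        regroup = solve-∀

    *-cong-mod : ∀ {a b a′ b′} → a ≡ b mod d → a′ ≡ b′ mod d →
                 a * a′ ≡ b * b′ mod d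
    *-cong-mod {a} {b} {a′} {b′} (≡-mod d∣a-b) (≡-mod d∣a′-b′) =
      ≡-mod (subst (d ∣_) (regroup a b a′ b′)
        (∣m∣n⇒∣m+n (∣m⇒∣m*n a′ d∣a-b) (∣n⇒∣m*n b d∣a′-b′)))
      where
        regroup : ∀ a b a′ b′ → (a - b) * a′ + b * (a′ - b′) ≡ a * a′ - b * b′
        regroup = solve-∀

    *-congˡ-mod : ∀ c {a b} → a ≡ b mod d → c * a ≡ c * b mod d
    *-congˡ-mod c = *-cong-mod (≡-mod-refl {c})

    +-congˡ-mod : ∀ a {b c} → b ≡ c mod d → a + b ≡ a + c mod d
    +-congˡ-mod a = +-cong-mod (≡-mod-refl {a})

    *-congʳ-mod : ∀ c {a b} → a ≡ b mod d → a * c ≡ b * c mod d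
    *-congʳ-mod c a≡b = *-cong-mod a≡b (≡-mod-refl {c})

    ∣⇒≡0-mod : ∀ {a} → d ∣ a → a ≡ 0ℤ mod d
    ∣⇒≡0-mod {a} d∣a = ≡-mod (subst (d ∣_) (sym (ℤ.+-identityʳ a)) d∣a)

    ∣-resp-≡-mod : ∀ {a b} → a ≡ b mod d → d ∣ b → d ∣ a
    ∣-resp-≡-mod {a} {b} (≡-mod d∣a-b) d∣b =
      subst (d ∣_) (cancel a b) (∣m∣n⇒∣m+n d∣a-b d∣b)
      where
        cancel : ∀ a b → (a - b) + b ≡ a
        cancel = solve-∀

  ≡-mod-setoid : ℤ → Setoid _ _
  ≡-mod-setoid d = record { isEquivalence = ≡-mod-isEquivalence {d} }

  module ≡-mod-Reasoning (d : ℤ) where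
    open import Relation.Binary.Reasoning.Setoid (≡-mod-setoid d) public

  ∣ᵤ⇒≡-mod : ∀ {d a b} → d Unsigned.∣ a - b → a ≡ b mod d
  ∣ᵤ⇒≡-mod d∣a-b = ≡-mod (∣ᵤ⇒∣ d∣a-b)

  ≡-mod⇒∣ᵤ : ∀ {d a b} → a ≡ b mod d → d Unsigned.∣ a - b
  ≡-mod⇒∣ᵤ (≡-mod d∣a-b) = ∣⇒∣ᵤ d∣a-b

  ≡-mod-weaken : ∀ {d d′ a b} → d ∣ d′ → a ≡ b mod d′ → a ≡ b mod d
  ≡-mod-weaken d∣d′ (≡-mod d′∣a-b) = ≡-mod (∣-trans d∣d′ d′∣a-b)

  -- Finite sums

  sumFin≡sum : ∀ {n} (f : Vector ℤ n) → sumFin f ≡ sum f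
  sumFin≡sum {zero}  f = refl
  sumFin≡sum {suc n} f = cong (_+_ (f zero)) (sumFin≡sum (f ∘ suc))

  sumFin-cong : ∀ {n} {f g : Vector ℤ n} → (∀ i → f i ≡ g i) → sumFin f ≡ sumFin g
  sumFin-cong {zero}  f≗g = refl
  sumFin-cong {suc n} f≗g = cong₂ _+_ (f≗g zero) (sumFin-cong (f≗g ∘ suc))

  sumFin-cong-mod : ∀ {n d} {f g : Vector ℤ n} → (∀ i → f i ≡ g i mod d) →
                    sumFin f ≡ sumFin g mod d
  sumFin-cong-mod {zero}  f≡g = ≡-mod-refl
  sumFin-cong-mod {suc n} f≡g = +-cong-mod (f≡g zero) (sumFin-cong-mod (f≡g ∘ suc))

  ∣-sumFin : ∀ {n d} (f : Vector ℤ n) → (∀ i → d ∣ f i) → d ∣ sumFin f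
  ∣-sumFin {zero}  {d} f d∣f = divides 0ℤ (sym (ℤ.*-zeroˡ d))
  ∣-sumFin {suc n}     f d∣f = ∣m∣n⇒∣m+n (d∣f zero) (∣-sumFin (f ∘ suc) (d∣f ∘ suc))

  sumFin-zero : ∀ {n} {f : Vector ℤ n} → (∀ i → f i ≡ 0ℤ) → sumFin f ≡ 0ℤ
  sumFin-zero {zero}  f≗0 = refl
  sumFin-zero {suc n} f≗0 = cong₂ _+_ (f≗0 zero) (sumFin-zero (f≗0 ∘ suc))

  sumFin-distrib-+ : ∀ {n} (f g : Vector ℤ n) →
                     sumFin (λ i → f i + g i) ≡ sumFin f + sumFin g
  sumFin-distrib-+ f g = begin
    sumFin (λ i → f i + g i)  ≡⟨ sumFin≡sum (λ i → f i + g i) ⟩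
    sum (λ i → f i + g i)     ≡⟨ ∑-distrib-+ f g ⟩
    sum f + sum g             ≡⟨ cong₂ _+_ (sumFin≡sum f) (sumFin≡sum g) ⟨
    sumFin f + sumFin g       ∎
    where open ≡-Reasoning

  sumFin-comm : ∀ {m n} (f : Fin m → Fin n → ℤ) →
                sumFin (λ i → sumFin (f i)) ≡ sumFin (λ j → sumFin (λ i → f i j))
  sumFin-comm f = begin
    sumFin (λ i → sumFin (f i))            ≡⟨ sumFin≡sum (λ i → sumFin (f i)) ⟩
    sum (λ i → sumFin (f i))               ≡⟨ sumFin≡sum-inner f ⟩
    sum (λ i → sum (f i))                  ≡⟨ ∑-comm f ⟩
    sum (λ j → sum (λ i → f i j))          ≡⟨ sumFin≡sum-inner (λ i j → f j i) ⟨
    sum (λ j → sumFin (λ i → f i j))       ≡⟨ sumFin≡sum (λ j → sumFin (λ i → f i j)) ⟨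
    sumFin (λ j → sumFin (λ i → f i j))    ∎
    where
      open ≡-Reasoning
      sumFin≡sum-inner : ∀ {m n} (h : Fin m → Fin n → ℤ) →
                         sum (λ i → sumFin (h i)) ≡ sum (λ i → sum (h i))
      sumFin≡sum-inner h = begin
        sum (λ i → sumFin (h i))     ≡⟨ sumFin≡sum (λ i → sumFin (h i)) ⟨
        sumFin (λ i → sumFin (h i))  ≡⟨ sumFin-cong (λ i → sumFin≡sum (h i)) ⟩
        sumFin (λ i → sum (h i))     ≡⟨ sumFin≡sum (λ i → sum (h i)) ⟩
        sum (λ i → sum (h i))        ∎

  sumFin-*ˡ : ∀ {n} c (f : Vector ℤ n) → sumFin (λ i → c * f i) ≡ c * sumFin f
  sumFin-*ˡ {zero}  c f = sym (ℤ.*-zeroʳ c)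
  sumFin-*ˡ {suc n} c f = begin
    c * f zero + sumFin (λ i → c * f (suc i))  ≡⟨ cong (_+_ (c * f zero)) (sumFin-*ˡ c (f ∘ suc)) ⟩
    c * f zero + c * sumFin (f ∘ suc)          ≡⟨ ℤ.*-distribˡ-+ c (f zero) _ ⟨
    c * sumFin f                               ∎
    where open ≡-Reasoning

  sumFin-*ʳ : ∀ {n} c (f : Vector ℤ n) → sumFin (λ i → f i * c) ≡ sumFin f * c
  sumFin-*ʳ c f = begin
    sumFin (λ i → f i * c)  ≡⟨ sumFin-cong (λ i → ℤ.*-comm (f i) c) ⟩
    sumFin (λ i → c * f i)  ≡⟨ sumFin-*ˡ c f ⟩
    c * sumFin f            ≡⟨ ℤ.*-comm c _ ⟩
    sumFin f * c            ∎
    where open ≡-Reasoning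

  sumFin-neg : ∀ {n} (f : Vector ℤ n) → sumFin (λ i → - f i) ≡ - sumFin f
  sumFin-neg {zero}  f = refl
  sumFin-neg {suc n} f = begin
    - f zero + sumFin (λ i → - f (suc i))  ≡⟨ cong (_+_ (- f zero)) (sumFin-neg (f ∘ suc)) ⟩
    - f zero + - sumFin (f ∘ suc)          ≡⟨ ℤ.neg-distrib-+ (f zero) _ ⟨
    - sumFin f                             ∎
    where open ≡-Reasoning

  sumFin-δ : ∀ {n} (f : Vector ℤ n) i → (∀ l → l ≢ i → f l ≡ 0ℤ) → sumFin f ≡ f i
  sumFin-δ f zero f≡0 = begin
    f zero + sumFin (f ∘ suc)  ≡⟨ cong (_+_ (f zero)) (sumFin-zero (λ l → f≡0 (suc l) λ ())) ⟩
    f zero + 0ℤ                ≡⟨ ℤ.+-identityʳ (f zero) ⟩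
    f zero                     ∎
    where open ≡-Reasoning
  sumFin-δ f (suc i) f≡0 = begin
    f zero + sumFin (f ∘ suc)  ≡⟨ cong₂ _+_ (f≡0 zero λ ()) (sumFin-δ (f ∘ suc) i f∘suc≡0) ⟩
    0ℤ + f (suc i)             ≡⟨ ℤ.+-identityˡ (f (suc i)) ⟩
    f (suc i)                  ∎
    where
      open ≡-Reasoning
      f∘suc≡0 : ∀ l → l ≢ i → f (suc l) ≡ 0ℤ
      f∘suc≡0 l l≢i = f≡0 (suc l) (l≢i ∘ Fin.suc-injective)

  infixl 6 _+ᵥ_
  infixr 7 _*ᵥ_

  _+ᵥ_ : ∀ {n} → Vector ℤ n → Vector ℤ n → Vector ℤ n
  (x +ᵥ y) i = x i + y i

  _*ᵥ_ : ∀ {n} → ℤ → Vector ℤ n → Vector ℤ n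
  (c *ᵥ x) i = c * x i

  matVec : ∀ {n} → Mat n → Vector ℤ n → Vector ℤ n
  matVec M x i = sumFin (λ j → M i j * x j)

  matMul : ∀ {n} → Mat n → Mat n → Mat n
  matMul M N i l = sumFin (λ j → M i j * N j l)

  matVec-matMul : ∀ {n} (M N : Mat n) z i → matVec (matMul M N) z i ≡ matVec M (matVec N z) i
  matVec-matMul M N z i = begin
    sumFin (λ l → sumFin (λ j → M i j * N j l) * z l)    ≡⟨ sumFin-cong (λ l → sumFin-*ʳ (z l) (λ j → M i j * N j l)) ⟨
    sumFin (λ l → sumFin (λ j → M i j * N j l * z l))    ≡⟨ sumFin-comm (λ l j → M i j * N j l * z l) ⟩
    sumFin (λ j → sumFin (λ l → M i j * N j l * z l))    ≡⟨ sumFin-cong (λ j → sumFin-cong λ l → ℤ.*-assoc (M i j) (N j l) (z l)) ⟩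
    sumFin (λ j → sumFin (λ l → M i j * (N j l * z l)))  ≡⟨ sumFin-cong (λ j → sumFin-*ˡ (M i j) (λ l → N j l * z l)) ⟩
    sumFin (λ j → M i j * sumFin (λ l → N j l * z l))    ∎
    where open ≡-Reasoning

  matVec-cong : ∀ {n} (M : Mat n) {z z′} → (∀ j → z j ≡ z′ j) → ∀ i → matVec M z i ≡ matVec M z′ i
  matVec-cong M z≗z′ i = sumFin-cong (λ j → cong (M i j *_) (z≗z′ j))

  matVec-congʳ-mod : ∀ {n d} (M : Mat n) {z z′} → (∀ j → z j ≡ z′ j mod d) →
                     ∀ i → matVec M z i ≡ matVec M z′ i mod d
  matVec-congʳ-mod M z≡z′ i = sumFin-cong-mod (λ j → *-congˡ-mod (M i j) (z≡z′ j))

  matVec-congˡ-mod : ∀ {n d} {M M′ : Mat n} z → (∀ i j → M i j ≡ M′ i j mod d) →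
                     ∀ i → matVec M z i ≡ matVec M′ z i mod d
  matVec-congˡ-mod z M≡M′ i = sumFin-cong-mod (λ j → *-cong-mod (M≡M′ i j) (≡-mod-refl {a = z j}))

  -- Bilinear forms

  bil-cong : ∀ {n} (A : Mat n) {x x′ y y′ : Vector ℤ n} →
    (∀ i → x i ≡ x′ i) → (∀ i → y i ≡ y′ i) → bil A x y ≡ bil A x′ y′
  bil-cong A x≗x′ y≗y′ =
    sumFin-cong (λ i → sumFin-cong (λ j → cong₂ (λ a b → A i j * a * b) (x≗x′ i) (y≗y′ j)))

  bil-cong-mod : ∀ {n d} (A : Mat n) {x y : Vector ℤ n} →
    (∀ i → x i ≡ y i mod d) → bil A x x ≡ bil A y y mod d
  bil-cong-mod A x≡y = sumFin-cong-mod (λ i → sumFin-cong-mod (λ j →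
    *-cong-mod (*-congˡ-mod (A i j) (x≡y i)) (x≡y j)))

  bil≡Σ*matVec : ∀ {n} (A : Mat n) x y → bil A x y ≡ sumFin (λ i → x i * matVec A y i)
  bil≡Σ*matVec A x y = sumFin-cong λ i → begin
    sumFin (λ j → A i j * x i * y j)    ≡⟨ sumFin-cong (λ j → reorder (A i j) (x i) (y j)) ⟩
    sumFin (λ j → x i * (A i j * y j))  ≡⟨ sumFin-*ˡ (x i) (λ j → A i j * y j) ⟩
    x i * matVec A y i                  ∎
    where
      open ≡-Reasoning
      reorder : ∀ a b c → a * b * c ≡ b * (a * c)
      reorder = solve-∀

  module BilinearForm {n} (A : Mat n) (A-sym : Symmetric A) where

    B : Vector ℤ n → Vector ℤ n → ℤ
    B = bil A

    Q : Vector ℤ n → ℤ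
    Q x = B x x

    B-sym : ∀ x y → B x y ≡ B y x
    B-sym x y = begin
      sumFin (λ i → sumFin (λ j → A i j * x i * y j))  ≡⟨ sumFin-comm (λ i j → A i j * x i * y j) ⟩
      sumFin (λ j → sumFin (λ i → A i j * x i * y j))  ≡⟨ sumFin-cong (λ j → sumFin-cong λ i → swap i j) ⟩
      sumFin (λ j → sumFin (λ i → A j i * y j * x i))  ∎
      where
        open ≡-Reasoning
        reorder : ∀ a b c → a * b * c ≡ a * c * b
        reorder = solve-∀
        swap : ∀ i j → A i j * x i * y j ≡ A j i * y j * x i
        swap i j = trans (cong (λ a → a * x i * y j) (A-sym i j)) (reorder (A j i) (x i) (y j))

    B-linearˡ : ∀ x t y z → B (x +ᵥ t *ᵥ y) z ≡ B x z + t * B y z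
    B-linearˡ x t y z = begin
      B (x +ᵥ t *ᵥ y) z                                          ≡⟨ bil≡Σ*matVec A _ z ⟩
      sumFin (λ i → (x i + t * y i) * w i)                       ≡⟨ sumFin-cong (λ i → expand (x i) t (y i) (w i)) ⟩
      sumFin (λ i → x i * w i + t * (y i * w i))                 ≡⟨ sumFin-distrib-+ (λ i → x i * w i) (λ i → t * (y i * w i)) ⟩
      sumFin (λ i → x i * w i) + sumFin (λ i → t * (y i * w i))  ≡⟨ cong (_+_ (sumFin (λ i → x i * w i))) (sumFin-*ˡ t (λ i → y i * w i)) ⟩
      sumFin (λ i → x i * w i) + t * sumFin (λ i → y i * w i)    ≡⟨ cong₂ (λ a b → a + t * b) (bil≡Σ*matVec A x z) (bil≡Σ*matVec A y z) ⟨
      B x z + t * B y z                                          ∎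
      where
        open ≡-Reasoning
        w = matVec A z
        expand : ∀ a t b c → (a + t * b) * c ≡ a * c + t * (b * c)
        expand = solve-∀

    B-linearʳ : ∀ z x t y → B z (x +ᵥ t *ᵥ y) ≡ B z x + t * B z y
    B-linearʳ z x t y = begin
      B z (x +ᵥ t *ᵥ y)  ≡⟨ B-sym z _ ⟩
      B (x +ᵥ t *ᵥ y) z  ≡⟨ B-linearˡ x t y z ⟩
      B x z + t * B y z  ≡⟨ cong₂ (λ a b → a + t * b) (B-sym x z) (B-sym y z) ⟩
      B z x + t * B z y  ∎
      where open ≡-Reasoning

    B-*ˡ : ∀ c x z → B (c *ᵥ x) z ≡ c * B x z
    B-*ˡ c x z = begin
      B (c *ᵥ x) z                    ≡⟨ bil≡Σ*matVec A _ z ⟩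
      sumFin (λ i → c * x i * w i)    ≡⟨ sumFin-cong (λ i → ℤ.*-assoc c (x i) (w i)) ⟩
      sumFin (λ i → c * (x i * w i))  ≡⟨ sumFin-*ˡ c (λ i → x i * w i) ⟩
      c * sumFin (λ i → x i * w i)    ≡⟨ cong (c *_) (bil≡Σ*matVec A x z) ⟨
      c * B x z                       ∎
      where
        open ≡-Reasoning
        w = matVec A z

    Q-* : ∀ c x → Q (c *ᵥ x) ≡ (c * c) * Q x
    Q-* c x = begin
      B (c *ᵥ x) (c *ᵥ x)  ≡⟨ B-*ˡ c x _ ⟩
      c * B x (c *ᵥ x)     ≡⟨ cong (c *_) (trans (B-sym x _) (B-*ˡ c x x)) ⟩
      c * (c * Q x)        ≡⟨ ℤ.*-assoc c c (Q x) ⟨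
      (c * c) * Q x        ∎
      where open ≡-Reasoning

    Q-expand : ∀ x t y → Q (x +ᵥ t *ᵥ y) ≡ Q x + (+ 2 * t) * B x y + (t * t) * Q y
    Q-expand x t y = begin
      Q (x +ᵥ t *ᵥ y)                                       ≡⟨ B-linearˡ x t y _ ⟩
      B x (x +ᵥ t *ᵥ y) + t * B y (x +ᵥ t *ᵥ y)             ≡⟨ cong₂ (λ a b → a + t * b) (B-linearʳ x x t y) (B-linearʳ y x t y) ⟩
      (Q x + t * B x y) + t * (B y x + t * Q y)             ≡⟨ cong (λ b → (Q x + t * B x y) + t * (b + t * Q y)) (B-sym y x) ⟩
      (Q x + t * B x y) + t * (B x y + t * Q y)             ≡⟨ collect (Q x) t (B x y) (Q y) ⟩
      Q x + (+ 2 * t) * B x y + (t * t) * Q y               ∎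
      where
        open ≡-Reasoning
        collect : ∀ a t b c → (a + t * b) + t * (b + t * c) ≡ a + (+ 2 * t) * b + (t * t) * c
        collect = solve-∀

  module ℤₚ (p : ℕ) where

    open PAdic p

    P^m∣P^[k+m] : ∀ k m → P ^ m ∣ P ^ (k ℕ.+ m)
    P^m∣P^[k+m] zero    m = ∣-refl
    P^m∣P^[k+m] (suc k) m = ∣-trans (P^m∣P^[k+m] k m) (∣n⇒∣m*n P ∣-refl)

    P∣P^m : ∀ {m} → 1 ℕ.≤ m → P ∣ P ^ m
    P∣P^m {suc m} _ = ∣m⇒∣m*n (P ^ m) (∣-refl {P})

    IsZp⇒≡-mod : ∀ x → IsZp x → ∀ m → x (suc m) ≡ x m mod P ^ m
    IsZp⇒≡-mod x x∈ℤₚ m = ∣ᵤ⇒≡-mod (x∈ℤₚ m)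

    IsZp-stable : ∀ x → IsZp x → ∀ k m → x (k ℕ.+ m) ≡ x m mod P ^ m
    IsZp-stable x x∈ℤₚ zero    m = ≡-mod-refl
    IsZp-stable x x∈ℤₚ (suc k) m = ≡-mod-trans
      (≡-mod-weaken (P^m∣P^[k+m] k m) (IsZp⇒≡-mod x x∈ℤₚ (k ℕ.+ m)))
      (IsZp-stable x x∈ℤₚ k m)

    IsZp-≤ : ∀ x → IsZp x → ∀ {m m′} → m ℕ.≤ m′ → x m′ ≡ x m mod P ^ m
    IsZp-≤ x x∈ℤₚ {m} m≤m′ with ℕ.m≤n⇒∃[o]m+o≡n m≤m′
    ... | o , refl = subst (λ l → x l ≡ x m mod P ^ m) (ℕ.+-comm o m) (IsZp-stable x x∈ℤₚ o m)

    IsZp-≡-mod-P : ∀ x → IsZp x → ∀ {m} → 1 ℕ.≤ m → x m ≡ x 1 mod P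
    IsZp-≡-mod-P x x∈ℤₚ 1≤m = ≡-mod-weaken (P∣P^m {1} ℕ.≤-refl) (IsZp-≤ x x∈ℤₚ 1≤m)

    matAt : ∀ {n} → Mp n → ℕ → Mat n
    matAt g m i j = g i j m

    vecAt : ∀ {n} → Vp n → ℕ → Vector ℤ n
    vecAt x m i = x i m

    Id-refl : ∀ {n} (i : Fin n) m → Id i i m ≡ 1ℤ
    Id-refl i m with i Fin.≟ i
    ... | yes _  = refl
    ... | no i≢i = ⊥-elim (i≢i refl)

    Id-≢ : ∀ {n} {i j : Fin n} m → i ≢ j → Id i j m ≡ 0ℤ
    Id-≢ {i = i} {j} m i≢j with i Fin.≟ j
    ... | yes i≡j = ⊥-elim (i≢j i≡j)
    ... | no _    = refl

    Id-const : ∀ {n} (i j : Fin n) m m′ → Id i j m ≡ Id i j m′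
    Id-const i j m m′ with i Fin.≟ j
    ... | yes _ = refl
    ... | no _  = refl

    matVec-Id : ∀ {n} m (z : Vector ℤ n) i → matVec (matAt Id m) z i ≡ z i
    matVec-Id m z i = begin
      sumFin (λ l → Id i l m * z l)  ≡⟨ sumFin-δ (λ l → Id i l m * z l) i off-diagonal ⟩
      Id i i m * z i                 ≡⟨ cong (_* z i) (Id-refl i m) ⟩
      1ℤ * z i                       ≡⟨ ℤ.*-identityˡ (z i) ⟩
      z i                            ∎
      where
        open ≡-Reasoning
        off-diagonal : ∀ l → l ≢ i → Id i l m * z l ≡ 0ℤ
        off-diagonal l l≢i = trans (cong (_* z l) (Id-≢ m (l≢i ∘ sym))) (ℤ.*-zeroˡ (z l))

    matVec-column : ∀ {n} (M : Mat n) m l i → matVec M (λ t → Id t l m) i ≡ M i l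
    matVec-column M m l i = begin
      sumFin (λ t → M i t * Id t l m)  ≡⟨ sumFin-δ (λ t → M i t * Id t l m) l off-diagonal ⟩
      M i l * Id l l m                 ≡⟨ cong (M i l *_) (Id-refl l m) ⟩
      M i l * 1ℤ                       ≡⟨ ℤ.*-identityʳ (M i l) ⟩
      M i l                            ∎
      where
        open ≡-Reasoning
        off-diagonal : ∀ t → t ≢ l → M i t * Id t l m ≡ 0ℤ
        off-diagonal t t≢l = trans (cong (M i t *_) (Id-≢ m t≢l)) (ℤ.*-zeroʳ (M i t))

    ·m-IsZpMat : ∀ {n} {g h : Mp n} → IsZpMat g → IsZpMat h → IsZpMat (g ·m h)
    ·m-IsZpMat {g = g} {h} g∈ℤₚ h∈ℤₚ i l m = ≡-mod⇒∣ᵤ (sumFin-cong-mod (λ j →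
      *-cong-mod (IsZp⇒≡-mod (g i j) (g∈ℤₚ i j) m) (IsZp⇒≡-mod (h j l) (h∈ℤₚ j l) m)))

    ·v-IsZpVec : ∀ {n} {g : Mp n} {x : Vp n} → IsZpMat g → IsZpVec x → IsZpVec (g ·v x)
    ·v-IsZpVec {g = g} {x} g∈ℤₚ x∈ℤₚ i m = ≡-mod⇒∣ᵤ (sumFin-cong-mod (λ j →
      *-cong-mod (IsZp⇒≡-mod (g i j) (g∈ℤₚ i j) m) (IsZp⇒≡-mod (x j) (x∈ℤₚ j) m)))

    ·m-inverse : ∀ {n} (g h h′ g′ : Mp n) → (h ·m h′) ≈m Id → (g ·m g′) ≈m Id →
                 ((g ·m h) ·m (h′ ·m g′)) ≈m Id
    ·m-inverse g h h′ g′ hh′≈1 gg′≈1 i l m = ≡-mod⇒∣ᵤ (begin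
      matVec (matMul G H) (λ j → matMul H′ G′ j l) i     ≡⟨ matVec-matMul G H _ i ⟩
      matVec G (matVec H (λ j → matMul H′ G′ j l)) i     ≡⟨ matVec-cong G (λ j → matVec-matMul H H′ (λ t → G′ t l) j) i ⟨
      matVec G (matVec (matMul H H′) (λ t → G′ t l)) i   ≈⟨ matVec-congʳ-mod G HH′≡1 i ⟩
      matVec G (λ j → G′ j l) i                          ≈⟨ ∣ᵤ⇒≡-mod (gg′≈1 i l m) ⟩
      Id i l m                                           ∎)
      where
        open ≡-mod-Reasoning (P ^ m)
        G = matAt g m ; H = matAt h m ; H′ = matAt h′ m ; G′ = matAt g′ m
        HH′≡1 : ∀ j → matVec (matMul H H′) (λ t → G′ t l) j ≡ G′ j l mod P ^ m
        HH′≡1 j = ≡-mod-trans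
          (matVec-congˡ-mod {M = matMul H H′} {matAt Id m} (λ t → G′ t l) (λ a b → ∣ᵤ⇒≡-mod (hh′≈1 a b m)) j)
          (≡⇒≡-mod (matVec-Id m (λ t → G′ t l) j))

    InO-·m : ∀ {n} {A : Mat n} {g h : Mp n} → InO A g → InO A h → InO A (g ·m h)
    InO-·m {A = A} {g} {h} g∈O h∈O = record
      { integral     = ·m-IsZpMat {g = g} {h} (integral g∈O) (integral h∈O)
      ; inv          = inv h∈O ·m inv g∈O
      ; inv-integral = ·m-IsZpMat {g = inv h∈O} {inv g∈O} (inv-integral h∈O) (inv-integral g∈O)
      ; rinv         = ·m-inverse g h (inv h∈O) (inv g∈O) (rinv h∈O) (rinv g∈O)
      ; linv         = ·m-inverse (inv h∈O) (inv g∈O) g h (linv g∈O) (linv h∈O)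
      ; isometry     = isometry-gh
      }
      where
        open InO
        isometry-gh : ∀ x → IsZpVec x → Qp A ((g ·m h) ·v x) ≈ Qp A x
        isometry-gh x x∈ℤₚ m = ≡-mod⇒∣ᵤ (begin
          bil A (vecAt ((g ·m h) ·v x) m) (vecAt ((g ·m h) ·v x) m)
            ≡⟨ bil-cong A (matVec-matMul G H X) (matVec-matMul G H X) ⟩
          bil A (vecAt (g ·v (h ·v x)) m) (vecAt (g ·v (h ·v x)) m)
            ≈⟨ ∣ᵤ⇒≡-mod (isometry g∈O (h ·v x) (·v-IsZpVec {g = h} {x} (integral h∈O) x∈ℤₚ) m) ⟩
          bil A (vecAt (h ·v x) m) (vecAt (h ·v x) m)
            ≈⟨ ∣ᵤ⇒≡-mod (isometry h∈O x x∈ℤₚ m) ⟩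
          bil A X X ∎)
          where
            open ≡-mod-Reasoning (P ^ m)
            G = matAt g m ; H = matAt h m ; X = vecAt x m

    same-coset⇒≡-mod : ∀ {n} {A : Mat n} k (u : Vp n) {g h : Mp n} (g∈O : InO A g) →
      InStab k u (InO.inv g∈O ·m h) → ∀ i → (g ·v u) i k ≡ (h ·v u) i k mod P ^ k
    same-coset⇒≡-mod k u {g} {h} g∈O g⁻¹h∈Stab i = begin
      matVec G U i                              ≈⟨ matVec-congʳ-mod G (λ j → ≡-mod-sym (∣ᵤ⇒≡-mod (g⁻¹h∈Stab j))) i ⟩
      matVec G (matVec (matMul G⁻¹ H) U) i      ≡⟨ matVec-cong G (λ j → matVec-matMul G⁻¹ H U j) i ⟩
      matVec G (matVec G⁻¹ (matVec H U)) i      ≡⟨ matVec-matMul G G⁻¹ (matVec H U) i ⟨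
      matVec (matMul G G⁻¹) (matVec H U) i      ≈⟨ matVec-congˡ-mod {M = matMul G G⁻¹} {matAt Id k} (matVec H U)
                                                     (λ a b → ∣ᵤ⇒≡-mod (InO.rinv g∈O a b k)) i ⟩
      matVec (matAt Id k) (matVec H U) i        ≡⟨ matVec-Id k (matVec H U) i ⟩
      matVec H U i                              ∎
      where
        open ≡-mod-Reasoning (P ^ k)
        G = matAt g k ; G⁻¹ = matAt (InO.inv g∈O) k ; H = matAt h k ; U = vecAt u k

  module NewtonInverse (p : ℕ) (q c : ℤ) (qc≡1 : q * c ≡ 1ℤ mod + p) where

    open PAdic p
    open ℤₚ p

    inverse : Seq
    inverse zero    = c
    inverse (suc m) = inverse m * (+ 2 - q * inverse m)

    inverse-correct : ∀ m → P ^ suc m ∣ q * inverse m - 1ℤ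
    inverse-correct zero    = ∣-trans (∣-reflexive (ℤ.*-identityʳ P)) (∣-diff qc≡1)
    inverse-correct (suc m) = subst (P ^ suc (suc m) ∣_) (newton-step q (inverse m))
      (∣m⇒∣-m (∣-trans (*-monoˡ-∣ (P ^ suc m) (∣-trans (P∣P^m {suc m} (ℕ.s≤s ℕ.z≤n)) (inverse-correct m)))
               (*-monoʳ-∣ (q * inverse m - 1ℤ) (inverse-correct m))))
      where
        newton-step : ∀ q c → - ((q * c - 1ℤ) * (q * c - 1ℤ)) ≡ q * (c * (+ 2 - q * c)) - 1ℤ
        newton-step = solve-∀

    inverse-≡-mod : ∀ m → q * inverse m ≡ 1ℤ mod P ^ m
    inverse-≡-mod m = ≡-mod (∣-trans (P^m∣P^[k+m] 1 m) (inverse-correct m))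

    inverse-IsZp : IsZp inverse
    inverse-IsZp m = ∣⇒∣ᵤ (subst (P ^ m ∣_) (difference q (inverse m))
      (∣n⇒∣m*n (- inverse m) (∣-trans (P^m∣P^[k+m] 1 m) (inverse-correct m))))
      where
        difference : ∀ q c → (- c) * (q * c - 1ℤ) ≡ c * (+ 2 - q * c) - c
        difference = solve-∀

  -- With c an inverse of Q v modulo d, reflect c is the reflection in v⊥, modulo d.
  module Reflection {n} (A : Mat n) (A-sym : Symmetric A) (v : Vector ℤ n) where

    open BilinearForm A A-sym

    reflect : ℤ → Vector ℤ n → Vector ℤ n
    reflect c z = z +ᵥ (- (+ 2 * c * B z v)) *ᵥ v

    reflect-* : ∀ c t y i → reflect c (t *ᵥ y) i ≡ t * reflect c y i
    reflect-* c t y i = begin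
      t * y i + (- (+ 2 * c * B (t *ᵥ y) v)) * v i  ≡⟨ cong (λ b → t * y i + (- (+ 2 * c * b)) * v i) (B-*ˡ t y v) ⟩
      t * y i + (- (+ 2 * c * (t * B y v))) * v i   ≡⟨ factor t (y i) c (B y v) (v i) ⟩
      t * (y i + (- (+ 2 * c * B y v)) * v i)       ∎
      where
        open ≡-Reasoning
        factor : ∀ t y c b v → t * y + (- (+ 2 * c * (t * b))) * v ≡ t * (y + (- (+ 2 * c * b)) * v)
        factor = solve-∀

    module _ {c d : ℤ} (Qv·c≡1 : Q v * c ≡ 1ℤ mod d) where

      private
        Qv·c-1≡0 : Q v * c - 1ℤ ≡ 0ℤ mod d
        Qv·c-1≡0 = ∣⇒≡0-mod (∣-diff Qv·c≡1)

      reflect-involutive : ∀ z i → reflect c (reflect c z) i ≡ z i mod d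
      reflect-involutive z i = begin
        reflect c (reflect c z) i
          ≡⟨ cong (λ b′ → reflect c z i + (- (+ 2 * c * b′)) * v i) (B-linearˡ z (- (+ 2 * c * b)) v v) ⟩
        (z i + (- (+ 2 * c * b)) * v i) + (- (+ 2 * c * (b + (- (+ 2 * c * b)) * Q v))) * v i
          ≡⟨ collect (z i) c b (v i) (Q v) ⟩
        z i + (+ 4 * c * b * v i) * (Q v * c - 1ℤ)
          ≈⟨ +-congˡ-mod (z i) (*-congˡ-mod (+ 4 * c * b * v i) Qv·c-1≡0) ⟩
        z i + (+ 4 * c * b * v i) * 0ℤ
          ≡⟨ drop (z i) (+ 4 * c * b * v i) ⟩
        z i ∎
        where
          open ≡-mod-Reasoning d
          b = B z v
          collect : ∀ z c b v q → (z + (- (+ 2 * c * b)) * v) + (- (+ 2 * c * (b + (- (+ 2 * c * b)) * q))) * v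
                                  ≡ z + (+ 4 * c * b * v) * (q * c - 1ℤ)
          collect = solve-∀
          drop : ∀ a k → a + k * 0ℤ ≡ a
          drop = solve-∀

      reflect-isometry : ∀ z → Q (reflect c z) ≡ Q z mod d
      reflect-isometry z = begin
        Q (reflect c z)                                  ≡⟨ Q-expand z (- (+ 2 * c * b)) v ⟩
        Q z + (+ 2 * - (+ 2 * c * b)) * b + (- (+ 2 * c * b) * - (+ 2 * c * b)) * Q v
                                                         ≡⟨ collect (Q z) c b (Q v) ⟩
        Q z + (+ 4 * c * b * b) * (Q v * c - 1ℤ)         ≈⟨ +-congˡ-mod (Q z) (*-congˡ-mod (+ 4 * c * b * b) Qv·c-1≡0) ⟩
        Q z + (+ 4 * c * b * b) * 0ℤ                     ≡⟨ drop (Q z) (+ 4 * c * b * b) ⟩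
        Q z                                              ∎
        where
          open ≡-mod-Reasoning d
          b = B z v
          collect : ∀ a c b q → a + (+ 2 * - (+ 2 * c * b)) * b + (- (+ 2 * c * b) * - (+ 2 * c * b)) * q
                                ≡ a + (+ 4 * c * b * b) * (q * c - 1ℤ)
          collect = solve-∀
          drop : ∀ a k → a + k * 0ℤ ≡ a
          drop = solve-∀

      -- For v = Y + σ X with Q Y ≡ Q X we get 2 B(Y, v) ≡ Q v, so the reflection sends Y to Y − v.
      reflect-sends : ∀ (Y X : Vector ℤ n) σ → σ * σ ≡ 1ℤ → (∀ i → v i ≡ Y i + σ * X i) →
                      Q Y ≡ Q X mod d → ∀ i → reflect c Y i ≡ - (σ * X i) mod d
      reflect-sends Y X σ σ²≡1 v≗Y+σX QY≡QX i = begin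
        Y i + (- (+ 2 * c * B Y v)) * v i      ≡⟨ regroup (Y i) c (B Y v) (v i) ⟩
        Y i - c * (+ 2 * B Y v) * v i          ≈⟨ +-congˡ-mod (Y i) (neg-cong-mod (*-congʳ-mod (v i) (*-congˡ-mod c 2B[Y,v]≡Qv))) ⟩
        Y i - c * Q v * v i                    ≡⟨ cong (λ a → Y i - a * v i) (ℤ.*-comm c (Q v)) ⟩
        Y i - Q v * c * v i                    ≈⟨ +-congˡ-mod (Y i) (neg-cong-mod (*-congʳ-mod (v i) Qv·c≡1)) ⟩
        Y i - 1ℤ * v i                         ≡⟨ cong (λ a → Y i - 1ℤ * a) (v≗Y+σX i) ⟩
        Y i - 1ℤ * (Y i + σ * X i)             ≡⟨ cancel (Y i) (σ * X i) ⟩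
        - (σ * X i)                            ∎
        where
          open ≡-mod-Reasoning d
          regroup : ∀ y c b v → y + (- (+ 2 * c * b)) * v ≡ y - c * (+ 2 * b) * v
          regroup = solve-∀
          cancel : ∀ y x → y - 1ℤ * (y + x) ≡ - x
          cancel = solve-∀
          2B[Y,v]≡Qv : + 2 * B Y v ≡ Q v mod d
          2B[Y,v]≡Qv = begin
            + 2 * B Y v                                     ≡⟨ cong (+ 2 *_) (trans (bil-cong A (λ _ → refl) v≗Y+σX) (B-linearʳ Y Y σ X)) ⟩
            + 2 * (Q Y + σ * B Y X)                         ≡⟨ split (Q Y) σ (B Y X) ⟩
            Q Y + (+ 2 * σ) * B Y X + 1ℤ * Q Y              ≈⟨ +-congˡ-mod (Q Y + (+ 2 * σ) * B Y X) (*-congˡ-mod 1ℤ QY≡QX) ⟩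
            Q Y + (+ 2 * σ) * B Y X + 1ℤ * Q X              ≡⟨ cong (λ s → Q Y + (+ 2 * σ) * B Y X + s * Q X) σ²≡1 ⟨
            Q Y + (+ 2 * σ) * B Y X + (σ * σ) * Q X         ≡⟨ Q-expand Y σ X ⟨
            Q (Y +ᵥ σ *ᵥ X)                                 ≡⟨ bil-cong A v≗Y+σX v≗Y+σX ⟨
            Q v                                             ∎
            where
              split : ∀ a σ b → + 2 * (a + σ * b) ≡ a + (+ 2 * σ) * b + 1ℤ * a
              split = solve-∀

  -- The matrix of ± the reflection in v⊥, over ℤ_p: its level-m entries use the
  -- Newton approximation of (Q v)⁻¹ modulo p^(m+1).
  module ReflectionMatrix (p : ℕ) {n} (A : Mat n) (A-sym : Symmetric A) (v : Vector ℤ n)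
                          (c : ℤ) (Qv·c≡1 : bil A v v * c ≡ 1ℤ mod + p)
                          (s : ℤ) (s*s≡1 : s * s ≡ 1ℤ) where

    open PAdic p
    open ℤₚ p
    open BilinearForm A A-sym
    open Reflection A A-sym v
    open NewtonInverse p (Q v) c Qv·c≡1

    Av : Vector ℤ n
    Av = matVec A v

    R : Mp n
    R i l m = s * (Id i l m - + 2 * inverse m * v i * Av l)

    R-matVec : ∀ m z i → matVec (matAt R m) z i ≡ s * reflect (inverse m) z i
    R-matVec m z i = begin
      sumFin (λ l → s * (Id i l m - + 2 * C * v i * Av l) * z l)
        ≡⟨ sumFin-cong (λ l → split s (Id i l m) C (v i) (Av l) (z l)) ⟩
      sumFin (λ l → s * (Id i l m * z l) + K * (z l * Av l))
        ≡⟨ sumFin-distrib-+ (λ l → s * (Id i l m * z l)) (λ l → K * (z l * Av l)) ⟩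
      sumFin (λ l → s * (Id i l m * z l)) + sumFin (λ l → K * (z l * Av l))
        ≡⟨ cong₂ _+_ (sumFin-*ˡ s (λ l → Id i l m * z l)) (sumFin-*ˡ K (λ l → z l * Av l)) ⟩
      s * matVec (matAt Id m) z i + K * sumFin (λ l → z l * Av l)
        ≡⟨ cong₂ (λ a b → s * a + K * b) (matVec-Id m z i) (sym (bil≡Σ*matVec A z v)) ⟩
      s * z i + K * B z v
        ≡⟨ factor s (z i) C (v i) (B z v) ⟩
      s * reflect C z i ∎
      where
        open ≡-Reasoning
        C = inverse m
        K = - (s * + 2 * C * v i)
        split : ∀ s δ C v w z → s * (δ - + 2 * C * v * w) * z ≡ s * (δ * z) + (- (s * + 2 * C * v)) * (z * w)
        split = solve-∀
        factor : ∀ s z C v b → s * z + (- (s * + 2 * C * v)) * b ≡ s * (z + (- (+ 2 * C * b)) * v)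
        factor = solve-∀

    R-IsZp : IsZpMat R
    R-IsZp i l m = ∣⇒∣ᵤ (subst (P ^ m ∣_) difference
      (∣n⇒∣m*n (- (s * + 2 * v i * Av l)) (∣ᵤ⇒∣ (inverse-IsZp m))))
      where
        regroup : ∀ s δ C′ C v w → (- (s * + 2 * v * w)) * (C′ - C) ≡ s * (δ - + 2 * C′ * v * w) - s * (δ - + 2 * C * v * w)
        regroup = solve-∀
        difference : (- (s * + 2 * v i * Av l)) * (inverse (suc m) - inverse m) ≡ R i l (suc m) - R i l m
        difference = trans (regroup s (Id i l m) (inverse (suc m)) (inverse m) (v i) (Av l))
          (cong (λ δ → s * (δ - + 2 * inverse (suc m) * v i * Av l) - R i l m) (Id-const i l m (suc m)))

    R-involutive : (R ·m R) ≈m Id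
    R-involutive i l m = ≡-mod⇒∣ᵤ (begin
      matVec (matAt R m) (λ j → R j l m) i                ≡⟨ matVec-cong (matAt R m) column i ⟩
      matVec (matAt R m) (s *ᵥ reflect C e) i             ≡⟨ R-matVec m (s *ᵥ reflect C e) i ⟩
      s * reflect C (s *ᵥ reflect C e) i                  ≡⟨ cong (s *_) (reflect-* C s (reflect C e) i) ⟩
      s * (s * reflect C (reflect C e) i)                 ≡⟨ ℤ.*-assoc s s _ ⟨
      (s * s) * reflect C (reflect C e) i                 ≡⟨ cong (_* reflect C (reflect C e) i) s*s≡1 ⟩
      1ℤ * reflect C (reflect C e) i                      ≡⟨ ℤ.*-identityˡ _ ⟩
      reflect C (reflect C e) i                           ≈⟨ reflect-involutive (inverse-≡-mod m) e i ⟩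
      Id i l m                                            ∎)
      where
        open ≡-mod-Reasoning (P ^ m)
        C = inverse m
        e = λ t → Id t l m
        column : ∀ j → R j l m ≡ s * reflect C e j
        column j = trans (sym (matVec-column (matAt R m) m l j)) (R-matVec m e j)

    R-isometric : ∀ m X → Q (matVec (matAt R m) X) ≡ Q X mod P ^ m
    R-isometric m X = begin
      Q (matVec (matAt R m) X)       ≡⟨ bil-cong A (R-matVec m X) (R-matVec m X) ⟩
      Q (s *ᵥ reflect C X)           ≡⟨ Q-* s (reflect C X) ⟩
      (s * s) * Q (reflect C X)      ≡⟨ cong (_* Q (reflect C X)) s*s≡1 ⟩
      1ℤ * Q (reflect C X)           ≡⟨ ℤ.*-identityˡ _ ⟩
      Q (reflect C X)                ≈⟨ reflect-isometry (inverse-≡-mod m) X ⟩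
      Q X                            ∎
      where
        open ≡-mod-Reasoning (P ^ m)
        C = inverse m

    R-isometry : ∀ x → IsZpVec x → Qp A (R ·v x) ≈ Qp A x
    R-isometry x _ m = ≡-mod⇒∣ᵤ (R-isometric m (vecAt x m))

    R∈O : InO A R
    R∈O = record
      { integral = R-IsZp ; inv = R ; inv-integral = R-IsZp
      ; rinv = R-involutive ; linv = R-involutive ; isometry = R-isometry }

    R-sends : ∀ k (Y X : Vector ℤ n) σ → σ * σ ≡ 1ℤ → s * σ ≡ -1ℤ →
              (∀ i → v i ≡ Y i + σ * X i) → Q Y ≡ Q X mod P ^ k →
              ∀ i → matVec (matAt R k) Y i ≡ X i mod P ^ k
    R-sends k Y X σ σ*σ≡1 s*σ≡-1 v≗Y+σX QY≡QX i = begin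
      matVec (matAt R k) Y i      ≡⟨ R-matVec k Y i ⟩
      s * reflect (inverse k) Y i ≈⟨ *-congˡ-mod s (reflect-sends (inverse-≡-mod k) Y X σ σ*σ≡1 v≗Y+σX QY≡QX i) ⟩
      s * - (σ * X i)             ≡⟨ regroup s σ (X i) ⟩
      - (s * σ) * X i             ≡⟨ cong (λ a → - a * X i) s*σ≡-1 ⟩
      1ℤ * X i                    ≡⟨ ℤ.*-identityˡ (X i) ⟩
      X i                         ∎
      where
        open ≡-mod-Reasoning (P ^ k)
        regroup : ∀ s σ x → s * - (σ * x) ≡ - (s * σ) * x
        regroup = solve-∀

  module OddPrime (p : ℕ) (p-prime : Prime p) (p≢2 : p ≢ 2) where

    P : ℤ
    P = + p

    Unit : ℤ → Set
    Unit a = ¬ P ∣ a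

    prime-divides-product : ∀ a b → P ∣ a * b → (P ∣ a) ⊎ (P ∣ b)
    prime-divides-product a b P∣ab with
      euclidsLemma ∣ a ∣ ∣ b ∣ p-prime (subst (p ℕ.∣_) (ℤ.abs-* a b) (∣⇒∣ᵤ P∣ab))
    ... | inj₁ p∣a = inj₁ (∣ᵤ⇒∣ p∣a)
    ... | inj₂ p∣b = inj₂ (∣ᵤ⇒∣ p∣b)

    Unit-* : ∀ {a b} → Unit a → Unit b → Unit (a * b)
    Unit-* {a} {b} a-unit b-unit P∣ab with prime-divides-product a b P∣ab
    ... | inj₁ P∣a = a-unit P∣a
    ... | inj₂ P∣b = b-unit P∣b

    Unit-neg : ∀ {a} → Unit a → Unit (- a)
    Unit-neg {a} a-unit P∣-a = a-unit (subst (P ∣_) (ℤ.neg-involutive a) (∣m⇒∣-m P∣-a))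

    Unit-resp-≡-mod : ∀ {a b} → a ≡ b mod P → Unit a → Unit b
    Unit-resp-≡-mod a≡b a-unit P∣b = a-unit (∣-resp-≡-mod a≡b P∣b)

    Unit-1 : Unit 1ℤ
    Unit-1 P∣1 = ¬prime[1] (subst Prime (ℕ.∣1⇒≡1 (∣⇒∣ᵤ P∣1)) p-prime)

    Unit-2 : Unit (+ 2)
    Unit-2 P∣2 with prime⇒irreducible prime[2] (∣⇒∣ᵤ P∣2)
    ... | inj₁ p≡1 = ¬prime[1] (subst Prime p≡1 p-prime)
    ... | inj₂ p≡2 = p≢2 p≡2

    Bézout⇒invertible : ∀ {a} → Bézout.Identity 1 a p → Σ ℤ λ c → + a * c ≡ 1ℤ mod P
    Bézout⇒invertible {a} (Bézout.+- x y eq) = + x , ≡-mod (divides (+ y) (begin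
      + a * + x - 1ℤ          ≡⟨ cong (_- 1ℤ) (ℤ.pos-* a x) ⟨
      + (a ℕ.* x) - 1ℤ        ≡⟨ cong (λ b → + b - 1ℤ) (trans (ℕ.*-comm a x) (sym eq)) ⟩
      + (1 ℕ.+ y ℕ.* p) - 1ℤ  ≡⟨ cong (_- 1ℤ) (trans (ℤ.pos-+ 1 (y ℕ.* p)) (cong (_+_ 1ℤ) (ℤ.pos-* y p))) ⟩
      1ℤ + + y * P - 1ℤ       ≡⟨ cancel (+ y * P) ⟩
      + y * P                 ∎))
      where
        open ≡-Reasoning
        cancel : ∀ b → 1ℤ + b - 1ℤ ≡ b
        cancel = solve-∀
    Bézout⇒invertible {a} (Bézout.-+ x y eq) = - + x , ≡-mod (divides (- + y) (begin
      + a * - + x - 1ℤ        ≡⟨ negate (+ a) (+ x) ⟩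
      - (1ℤ + + x * + a)      ≡⟨ cong (λ b → - (1ℤ + b)) (ℤ.pos-* x a) ⟨
      - (1ℤ + + (x ℕ.* a))    ≡⟨ cong -_ (ℤ.pos-+ 1 (x ℕ.* a)) ⟨
      - + (1 ℕ.+ x ℕ.* a)     ≡⟨ cong (λ b → - + b) eq ⟩
      - + (y ℕ.* p)           ≡⟨ cong -_ (ℤ.pos-* y p) ⟩
      - (+ y * P)             ≡⟨ ℤ.neg-distribˡ-* (+ y) P ⟩
      - + y * P               ∎))
      where
        open ≡-Reasoning
        negate : ∀ a x → a * - x - 1ℤ ≡ - (1ℤ + x * a)
        negate = solve-∀

    Unit⇒coprime : ∀ {q} → Unit q → Coprime ∣ q ∣ p
    Unit⇒coprime q-unit (d∣q , d∣p) with prime⇒irreducible p-prime d∣p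
    ... | inj₁ d≡1  = d≡1
    ... | inj₂ refl = contradiction (∣ᵤ⇒∣ d∣q) q-unit

    Unit⇒invertible : ∀ {q} → Unit q → Σ ℤ λ c → q * c ≡ 1ℤ mod P
    Unit⇒invertible {q} q-unit with ℤ.+∣i∣≡i⊎+∣i∣≡-i q | Bézout⇒invertible (coprime-Bézout (Unit⇒coprime q-unit))
    ... | inj₁ ∣q∣≡q  | c , ∣q∣c≡1 = c , subst (λ a → a * c ≡ 1ℤ mod P) ∣q∣≡q ∣q∣c≡1
    ... | inj₂ ∣q∣≡-q | c , ∣q∣c≡1 = - c , subst (_≡ 1ℤ mod P) (trans (cong (_* c) ∣q∣≡-q) (neg-swap q c)) ∣q∣c≡1
      where
        neg-swap : ∀ q c → - q * c ≡ q * - c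
        neg-swap = solve-∀

  -- Determinants

  sign : ∀ {n} → Fin n → ℤ
  sign j = altSign (toℕ' j)

  minor : ∀ {n} → Fin (suc n) → Mat (suc n) → Mat n
  minor j M i l = M (suc i) (punchIn j l)

  laplaceTerm : ∀ {n} → Fin (suc n) → Mat (suc n) → ℤ
  laplaceTerm j M = sign j * M zero j * det (minor j M)

  det-cong : ∀ {n} {M N : Mat n} → (∀ i j → M i j ≡ N i j) → det M ≡ det N
  det-cong {zero}  M≗N = refl
  det-cong {suc n} M≗N = sumFin-cong (λ j →
    cong₂ (λ a b → sign j * a * b) (M≗N zero j) (det-cong (λ i l → M≗N (suc i) (punchIn j l))))

  setColumn : ∀ {n} → Mat n → Fin n → Vector ℤ n → Mat n
  setColumn M l w i j with j Fin.≟ l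
  ... | yes _ = w i
  ... | no _  = M i j

  setColumn-≡ : ∀ {n} (M : Mat n) l w i → setColumn M l w i l ≡ w i
  setColumn-≡ M l w i with l Fin.≟ l
  ... | yes _  = refl
  ... | no l≢l = ⊥-elim (l≢l refl)

  setColumn-≢ : ∀ {n} (M : Mat n) l w i {j} → j ≢ l → setColumn M l w i j ≡ M i j
  setColumn-≢ M l w i {j} j≢l with j Fin.≟ l
  ... | yes j≡l = ⊥-elim (j≢l j≡l)
  ... | no _    = refl

  setColumn-self : ∀ {n} (M : Mat n) l i j → setColumn M l (λ t → M t l) i j ≡ M i j
  setColumn-self M l i j with j Fin.≟ l
  ... | yes refl = refl
  ... | no _     = refl

  IsLinear : ∀ {n} → (Vector ℤ n → ℤ) → Set
  IsLinear {n} F = Σ (Vector ℤ n) λ C → ∀ w → F w ≡ sumFin (λ i → w i * C i)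

  sumFin-IsLinear : ∀ {m n} (F : Fin m → Vector ℤ n → ℤ) → (∀ j → IsLinear (F j)) →
                    IsLinear (λ w → sumFin (λ j → F j w))
  sumFin-IsLinear F F-linear = (λ i → sumFin (λ j → C j i)) , λ w → begin
    sumFin (λ j → F j w)                           ≡⟨ sumFin-cong (λ j → proj₂ (F-linear j) w) ⟩
    sumFin (λ j → sumFin (λ i → w i * C j i))      ≡⟨ sumFin-comm (λ j i → w i * C j i) ⟩
    sumFin (λ i → sumFin (λ j → w i * C j i))      ≡⟨ sumFin-cong (λ i → sumFin-*ˡ (w i) (λ j → C j i)) ⟩
    sumFin (λ i → w i * sumFin (λ j → C j i))      ∎
    where
      open ≡-Reasoning
      C = λ j → proj₁ (F-linear j)

  minor-setColumn : ∀ {n} (M : Mat (suc n)) {j l} (j≢l : j ≢ l) w i t →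
    minor j (setColumn M l w) i t ≡ setColumn (minor j M) (punchOut j≢l) (w ∘ suc) i t
  minor-setColumn M {j} {l} j≢l w i t with t Fin.≟ punchOut j≢l
  ... | yes refl = trans (cong (setColumn M l w (suc i)) (Fin.punchIn-punchOut j≢l)) (setColumn-≡ M l w (suc i))
  ... | no t≢l′  = setColumn-≢ M l w (suc i)
    (λ eq → t≢l′ (Fin.punchIn-injective j t _ (trans eq (sym (Fin.punchIn-punchOut j≢l)))))

  laplaceTerm-setColumn-linear : ∀ {n} (M : Mat (suc n)) j → IsLinear (λ w → laplaceTerm j (setColumn M j w))
  laplaceTerm-setColumn-linear M j = (λ { zero → sign j * det (minor j M) ; (suc _) → 0ℤ }) , λ w → begin
    sign j * setColumn M j w zero j * det (minor j (setColumn M j w))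
      ≡⟨ cong₂ (λ a d → sign j * a * d) (setColumn-≡ M j w zero)
               (det-cong (λ i t → setColumn-≢ M j w (suc i) (Fin.punchInᵢ≢i j t))) ⟩
    sign j * w zero * det (minor j M)
      ≡⟨ reorder (sign j) (w zero) (det (minor j M)) ⟩
    w zero * (sign j * det (minor j M)) + 0ℤ
      ≡⟨ cong (_+_ (w zero * (sign j * det (minor j M)))) (sumFin-zero (λ i → ℤ.*-zeroʳ (w (suc i)))) ⟨
    w zero * (sign j * det (minor j M)) + sumFin (λ i → w (suc i) * 0ℤ) ∎
    where
      open ≡-Reasoning
      reorder : ∀ s a d → s * a * d ≡ a * (s * d) + 0ℤ
      reorder = solve-∀

  det-linear : ∀ {n} (M : Mat n) l → IsLinear (λ w → det (setColumn M l w))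
  det-linear {suc n} M l = sumFin-IsLinear _ (λ j → term j (j Fin.≟ l))
    where
      term : ∀ j → Dec (j ≡ l) → IsLinear (λ w → laplaceTerm j (setColumn M l w))
      term j (yes refl) = laplaceTerm-setColumn-linear M j
      term j (no j≢l) = (λ { zero → 0ℤ ; (suc i) → K * C i }) , λ w → begin
        sign j * setColumn M l w zero j * det (minor j (setColumn M l w))
          ≡⟨ cong₂ (λ a d → sign j * a * d) (setColumn-≢ M l w zero j≢l) (det-cong (minor-setColumn M j≢l w)) ⟩
        K * det (setColumn (minor j M) (punchOut j≢l) (w ∘ suc))
          ≡⟨ cong (K *_) (proj₂ IH (w ∘ suc)) ⟩
        K * sumFin (λ i → w (suc i) * C i)
          ≡⟨ sumFin-*ˡ K (λ i → w (suc i) * C i) ⟨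
        sumFin (λ i → K * (w (suc i) * C i))
          ≡⟨ sumFin-cong (λ i → reorder K (w (suc i)) (C i)) ⟩
        sumFin (λ i → w (suc i) * (K * C i))
          ≡⟨ ℤ.+-identityˡ _ ⟨
        0ℤ + sumFin (λ i → w (suc i) * (K * C i))
          ≡⟨ cong (_+ sumFin (λ i → w (suc i) * (K * C i))) (ℤ.*-zeroʳ (w zero)) ⟨
        w zero * 0ℤ + sumFin (λ i → w (suc i) * (K * C i)) ∎
        where
          open ≡-Reasoning
          K = sign j * M zero j
          IH = det-linear (minor j M) (punchOut j≢l)
          C = proj₁ IH
          reorder : ∀ K a b → K * (a * b) ≡ a * (K * b)
          reorder = solve-∀

  swapAdjacent : ∀ {n} → Fin n → Fin (suc n) → Fin (suc n)
  swapAdjacent zero    zero          = suc zero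
  swapAdjacent zero    (suc zero)    = zero
  swapAdjacent zero    (suc (suc j)) = suc (suc j)
  swapAdjacent (suc c) zero          = zero
  swapAdjacent (suc c) (suc j)       = suc (swapAdjacent c j)

  swapAdjacent-inject₁ : ∀ {n} (c : Fin n) → swapAdjacent c (inject₁ c) ≡ suc c
  swapAdjacent-inject₁ zero    = refl
  swapAdjacent-inject₁ (suc c) = cong suc (swapAdjacent-inject₁ c)

  swapAdjacent-suc : ∀ {n} (c : Fin n) → swapAdjacent c (suc c) ≡ inject₁ c
  swapAdjacent-suc zero    = refl
  swapAdjacent-suc (suc c) = cong suc (swapAdjacent-suc c)

  swapAdjacent-punchIn-inject₁ : ∀ {n} (c : Fin n) t →
    swapAdjacent c (punchIn (inject₁ c) t) ≡ punchIn (suc c) t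
  swapAdjacent-punchIn-inject₁ zero    zero    = refl
  swapAdjacent-punchIn-inject₁ zero    (suc t) = refl
  swapAdjacent-punchIn-inject₁ (suc c) zero    = refl
  swapAdjacent-punchIn-inject₁ (suc c) (suc t) = cong suc (swapAdjacent-punchIn-inject₁ c t)

  swapAdjacent-punchIn-suc : ∀ {n} (c : Fin n) t →
    swapAdjacent c (punchIn (suc c) t) ≡ punchIn (inject₁ c) t
  swapAdjacent-punchIn-suc zero    zero    = refl
  swapAdjacent-punchIn-suc zero    (suc t) = refl
  swapAdjacent-punchIn-suc (suc c) zero    = refl
  swapAdjacent-punchIn-suc (suc c) (suc t) = cong suc (swapAdjacent-punchIn-suc c t)

  swapAdjacent-fixes : ∀ {n} (c : Fin n) {j} → j ≢ inject₁ c → j ≢ suc c → swapAdjacent c j ≡ j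
  swapAdjacent-fixes zero    {zero}          j≢c j≢c+1 = ⊥-elim (j≢c refl)
  swapAdjacent-fixes zero    {suc zero}      j≢c j≢c+1 = ⊥-elim (j≢c+1 refl)
  swapAdjacent-fixes zero    {suc (suc j)}   j≢c j≢c+1 = refl
  swapAdjacent-fixes (suc c) {zero}          j≢c j≢c+1 = refl
  swapAdjacent-fixes (suc c) {suc j}         j≢c j≢c+1 =
    cong suc (swapAdjacent-fixes c (j≢c ∘ cong suc) (j≢c+1 ∘ cong suc))

  swapAdjacent-cases : ∀ {n} (c : Fin (suc n)) j →
    j ≡ inject₁ c ⊎ j ≡ suc c ⊎
    (swapAdjacent c j ≡ j × Σ (Fin n) λ c′ → ∀ t → swapAdjacent c (punchIn j t) ≡ punchIn j (swapAdjacent c′ t))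
  swapAdjacent-cases zero zero = inj₁ refl
  swapAdjacent-cases zero (suc zero) = inj₂ (inj₁ refl)
  swapAdjacent-cases {suc n} zero (suc (suc j)) = inj₂ (inj₂ (refl , zero , commute))
    where
      commute : ∀ t → swapAdjacent zero (punchIn (suc (suc j)) t) ≡ punchIn (suc (suc j)) (swapAdjacent zero t)
      commute zero          = refl
      commute (suc zero)    = refl
      commute (suc (suc t)) = refl
  swapAdjacent-cases (suc c) zero = inj₂ (inj₂ (refl , c , λ t → refl))
  swapAdjacent-cases {suc n} (suc c) (suc j) with swapAdjacent-cases c j
  ... | inj₁ j≡c             = inj₁ (cong suc j≡c)
  ... | inj₂ (inj₁ j≡c+1)    = inj₂ (inj₁ (cong suc j≡c+1))
  ... | inj₂ (inj₂ (fixed , c′ , commute)) = inj₂ (inj₂ (cong suc fixed , suc c′ , commute′))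
    where
      commute′ : ∀ t → swapAdjacent (suc c) (punchIn (suc j) t) ≡ punchIn (suc j) (swapAdjacent (suc c′) t)
      commute′ zero    = refl
      commute′ (suc t) = cong suc (commute t)

  toℕ'-inject₁ : ∀ {n} (c : Fin n) → toℕ' (inject₁ c) ≡ toℕ' c
  toℕ'-inject₁ zero    = refl
  toℕ'-inject₁ (suc c) = cong suc (toℕ'-inject₁ c)

  sumFin-swapAdjacent : ∀ {n} (c : Fin n) (f : Vector ℤ (suc n)) →
                        sumFin (λ j → f (swapAdjacent c j)) ≡ sumFin f
  sumFin-swapAdjacent zero    f = swap (f (suc zero)) (f zero) (sumFin (λ j → f (suc (suc j))))
    where
      swap : ∀ a b c → a + (b + c) ≡ b + (a + c)
      swap = solve-∀
  sumFin-swapAdjacent (suc c) f = cong (_+_ (f zero)) (sumFin-swapAdjacent c (f ∘ suc))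

  swapColumns : ∀ {n} → Fin n → Mat (suc n) → Mat (suc n)
  swapColumns c M i j = M i (swapAdjacent c j)

  laplaceTerm-swap-inject₁ : ∀ {n} (c : Fin n) (M : Mat (suc n)) →
    laplaceTerm (inject₁ c) (swapColumns c M) ≡ - laplaceTerm (suc c) M
  laplaceTerm-swap-inject₁ c M = begin
    altSign (toℕ' (inject₁ c)) * M zero (swapAdjacent c (inject₁ c)) * det (minor (inject₁ c) (swapColumns c M))
      ≡⟨ cong₂ (λ a d → altSign a * M zero (swapAdjacent c (inject₁ c)) * d) (toℕ'-inject₁ c)
               (det-cong (λ i t → cong (M (suc i)) (swapAdjacent-punchIn-inject₁ c t))) ⟩
    altSign (toℕ' c) * M zero (swapAdjacent c (inject₁ c)) * det (minor (suc c) M)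
      ≡⟨ cong (λ z → altSign (toℕ' c) * M zero z * det (minor (suc c) M)) (swapAdjacent-inject₁ c) ⟩
    altSign (toℕ' c) * M zero (suc c) * det (minor (suc c) M)
      ≡⟨ flip (altSign (toℕ' c)) (M zero (suc c)) (det (minor (suc c) M)) ⟩
    - laplaceTerm (suc c) M ∎
    where
      open ≡-Reasoning
      flip : ∀ s a d → s * a * d ≡ - ((- s) * a * d)
      flip = solve-∀

  laplaceTerm-swap-suc : ∀ {n} (c : Fin n) (M : Mat (suc n)) →
    laplaceTerm (suc c) (swapColumns c M) ≡ - laplaceTerm (inject₁ c) M
  laplaceTerm-swap-suc c M = begin
    - altSign (toℕ' c) * M zero (swapAdjacent c (suc c)) * det (minor (suc c) (swapColumns c M))
      ≡⟨ cong₂ (λ a d → - altSign a * M zero (swapAdjacent c (suc c)) * d) (sym (toℕ'-inject₁ c))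
               (det-cong (λ i t → cong (M (suc i)) (swapAdjacent-punchIn-suc c t))) ⟩
    - altSign (toℕ' (inject₁ c)) * M zero (swapAdjacent c (suc c)) * det (minor (inject₁ c) M)
      ≡⟨ cong (λ z → - altSign (toℕ' (inject₁ c)) * M zero z * det (minor (inject₁ c) M)) (swapAdjacent-suc c) ⟩
    - altSign (toℕ' (inject₁ c)) * M zero (inject₁ c) * det (minor (inject₁ c) M)
      ≡⟨ flip (altSign (toℕ' (inject₁ c))) (M zero (inject₁ c)) (det (minor (inject₁ c) M)) ⟩
    - laplaceTerm (inject₁ c) M ∎
    where
      open ≡-Reasoning
      flip : ∀ s a d → (- s) * a * d ≡ - (s * a * d)
      flip = solve-∀

  det-swapColumns : ∀ {n} (c : Fin n) (M : Mat (suc n)) → det (swapColumns c M) ≡ - det M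
  det-swapColumns {suc n} c M = begin
    sumFin (λ j → laplaceTerm j (swapColumns c M))      ≡⟨ sumFin-cong term ⟩
    sumFin (λ j → - laplaceTerm (swapAdjacent c j) M)   ≡⟨ sumFin-neg (λ j → laplaceTerm (swapAdjacent c j) M) ⟩
    - sumFin (λ j → laplaceTerm (swapAdjacent c j) M)   ≡⟨ cong -_ (sumFin-swapAdjacent c (λ j → laplaceTerm j M)) ⟩
    - det M                                             ∎
    where
      open ≡-Reasoning
      term : ∀ j → laplaceTerm j (swapColumns c M) ≡ - laplaceTerm (swapAdjacent c j) M
      term j with swapAdjacent-cases c j
      ... | inj₁ refl =
        trans (laplaceTerm-swap-inject₁ c M) (cong (λ z → - laplaceTerm z M) (sym (swapAdjacent-inject₁ c)))
      ... | inj₂ (inj₁ refl) =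
        trans (laplaceTerm-swap-suc c M) (cong (λ z → - laplaceTerm z M) (sym (swapAdjacent-suc c)))
      ... | inj₂ (inj₂ (fixed , c′ , commute)) = begin
        sign j * M zero (swapAdjacent c j) * det (minor j (swapColumns c M))
          ≡⟨ cong₂ (λ z d → sign j * M zero z * d) fixed (det-cong (λ i t → cong (M (suc i)) (commute t))) ⟩
        sign j * M zero j * det (swapColumns c′ (minor j M))
          ≡⟨ cong (sign j * M zero j *_) (det-swapColumns c′ (minor j M)) ⟩
        sign j * M zero j * - det (minor j M)
          ≡⟨ ℤ.neg-distribʳ-* (sign j * M zero j) (det (minor j M)) ⟨
        - laplaceTerm j M
          ≡⟨ cong (λ z → - laplaceTerm z M) fixed ⟨
        - laplaceTerm (swapAdjacent c j) M ∎

  i≡-i⇒i≡0 : ∀ {i} → i ≡ - i → i ≡ 0ℤ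
  i≡-i⇒i≡0 {+ zero}    _  = refl
  i≡-i⇒i≡0 {ℤ.+[1+ n ]} ()
  i≡-i⇒i≡0 {ℤ.-[1+ n ]} ()

  det-adjacent-columns : ∀ {n} (c : Fin n) (M : Mat (suc n)) →
    (∀ i → M i (inject₁ c) ≡ M i (suc c)) → det M ≡ 0ℤ
  det-adjacent-columns c M columns≡ = i≡-i⇒i≡0 (trans (det-cong swap-invariant) (det-swapColumns c M))
    where
      swap-invariant : ∀ i j → M i j ≡ M i (swapAdjacent c j)
      swap-invariant i j with j Fin.≟ inject₁ c | j Fin.≟ suc c
      ... | yes refl | _        = trans (columns≡ i) (cong (M i) (sym (swapAdjacent-inject₁ c)))
      ... | no _     | yes refl = trans (sym (columns≡ i)) (cong (M i) (sym (swapAdjacent-suc c)))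
      ... | no j≢c   | no j≢c+1 = cong (M i) (sym (swapAdjacent-fixes c j≢c j≢c+1))

  -- Column b is swapped leftwards until it is adjacent to column a; the fuel bounds toℕ b.
  det-equal-columns< : ∀ fuel {n} (M : Mat n) (a b : Fin n) → toℕ b ℕ.≤ fuel → toℕ a ℕ.< toℕ b →
                       (∀ i → M i a ≡ M i b) → det M ≡ 0ℤ
  det-equal-columns< fuel M a (suc c) b≤fuel a<b columns≡ with a Fin.≟ inject₁ c
  ... | yes refl = det-adjacent-columns c M columns≡
  det-equal-columns< (suc fuel) M a (suc c) (ℕ.s≤s c≤fuel) (ℕ.s≤s a≤c) columns≡ | no a≢c = begin
    det M                 ≡⟨ ℤ.neg-involutive (det M) ⟨
    - - det M             ≡⟨ cong -_ (det-swapColumns c M) ⟨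
    - det M′              ≡⟨ cong -_ (det-equal-columns< fuel M′ a (inject₁ c) c′≤fuel a<c′ columns′≡) ⟩
    - 0ℤ                  ∎
    where
      open ≡-Reasoning
      M′ = swapColumns c M
      c′≤fuel : toℕ (inject₁ c) ℕ.≤ fuel
      c′≤fuel = subst (ℕ._≤ fuel) (sym (Fin.toℕ-inject₁ c)) c≤fuel
      a<c′ : toℕ a ℕ.< toℕ (inject₁ c)
      a<c′ = ℕ.≤∧≢⇒< (subst (toℕ a ℕ.≤_) (sym (Fin.toℕ-inject₁ c)) a≤c) (a≢c ∘ Fin.toℕ-injective)
      a≢c+1 : a ≢ suc c
      a≢c+1 a≡c+1 = ℕ.<⇒≢ (ℕ.s≤s a≤c) (cong toℕ a≡c+1)
      columns′≡ : ∀ i → M′ i a ≡ M′ i (inject₁ c)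
      columns′≡ i = begin
        M i (swapAdjacent c a)          ≡⟨ cong (M i) (swapAdjacent-fixes c a≢c a≢c+1) ⟩
        M i a                           ≡⟨ columns≡ i ⟩
        M i (suc c)                     ≡⟨ cong (M i) (swapAdjacent-inject₁ c) ⟨
        M i (swapAdjacent c (inject₁ c)) ∎

  det-equal-columns : ∀ {n} (M : Mat n) {a b : Fin n} → a ≢ b → (∀ i → M i a ≡ M i b) → det M ≡ 0ℤ
  det-equal-columns M {a} {b} a≢b columns≡ with ℕ.<-cmp (toℕ a) (toℕ b)
  ... | tri< a<b _ _   = det-equal-columns< (toℕ b) M a b ℕ.≤-refl a<b columns≡
  ... | tri≈ _ a≡b _   = ⊥-elim (a≢b (Fin.toℕ-injective a≡b))
  ... | tri> _ _ b<a   = det-equal-columns< (toℕ a) M b a ℕ.≤-refl b<a (sym ∘ columns≡)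

  det-setColumn-matVec : ∀ {n} (A : Mat n) U l → det (setColumn A l (matVec A U)) ≡ U l * det A
  det-setColumn-matVec A U l = begin
    det (setColumn A l (matVec A U))                          ≡⟨ cofactor-expansion (matVec A U) ⟩
    sumFin (λ i → matVec A U i * C i)                         ≡⟨ sumFin-cong (λ i → sumFin-*ʳ (C i) (λ m → A i m * U m)) ⟨
    sumFin (λ i → sumFin (λ m → A i m * U m * C i))           ≡⟨ sumFin-comm (λ i m → A i m * U m * C i) ⟩
    sumFin (λ m → sumFin (λ i → A i m * U m * C i))           ≡⟨ sumFin-cong (λ m → sumFin-cong (λ i → reorder (A i m) (U m) (C i))) ⟩
    sumFin (λ m → sumFin (λ i → U m * (A i m * C i)))         ≡⟨ sumFin-cong (λ m → sumFin-*ˡ (U m) (λ i → A i m * C i)) ⟩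
    sumFin (λ m → U m * sumFin (λ i → A i m * C i))           ≡⟨ sumFin-cong (λ m → cong (U m *_) (cofactor-expansion (λ i → A i m))) ⟨
    sumFin (λ m → U m * det (setColumn A l (λ i → A i m)))    ≡⟨ sumFin-δ _ l other-columns ⟩
    U l * det (setColumn A l (λ i → A i l))                   ≡⟨ cong (U l *_) (det-cong (setColumn-self A l)) ⟩
    U l * det A                                               ∎
    where
      open ≡-Reasoning
      C = proj₁ (det-linear A l)
      cofactor-expansion = proj₂ (det-linear A l)
      reorder : ∀ a u c → a * u * c ≡ u * (a * c)
      reorder = solve-∀
      other-columns : ∀ m → m ≢ l → U m * det (setColumn A l (λ i → A i m)) ≡ 0ℤ
      other-columns m m≢l = trans (cong (U m *_) (det-equal-columns _ (m≢l ∘ sym) (λ i →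
        trans (setColumn-≡ A l _ i) (sym (setColumn-≢ A l _ i m≢l))))) (ℤ.*-zeroʳ (U m))

  ∣-matVec⇒∣-det : ∀ {n d} (A : Mat n) U → (∀ i → d ∣ matVec A U i) → ∀ l → d ∣ U l * det A
  ∣-matVec⇒∣-det A U d∣AU l = subst (_ ∣_)
    (trans (sym (proj₂ (det-linear A l) (matVec A U))) (det-setColumn-matVec A U l))
    (∣-sumFin _ (λ i → ∣m⇒∣m*n (proj₁ (det-linear A l) i) (d∣AU i)))

  module Transitivity (p : ℕ) (p-prime : Prime p) (p≢2 : p ≢ 2)
                      {n} (A : Mat n) (A-sym : Symmetric A) (k : ℕ) (1≤k : 1 ℕ.≤ k) where

    open PAdic p
    open ℤₚ p
    open OddPrime p p-prime p≢2 hiding (P)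
    open BilinearForm A A-sym

    mod-P : ∀ {a b} → a ≡ b mod P ^ k → a ≡ b mod P
    mod-P = ≡-mod-weaken (P∣P^m 1≤k)

    Carries : Mp n → Vector ℤ n → Vector ℤ n → Set
    Carries g Y X = ∀ i → matVec (matAt g k) Y i ≡ X i mod P ^ k

    infix 4 _⇝_

    _⇝_ : Vector ℤ n → Vector ℤ n → Set
    Y ⇝ X = Σ (Mp n) λ g → InO A g × Carries g Y X

    ⇝-trans : ∀ {X Y Z} → X ⇝ Y → Y ⇝ Z → X ⇝ Z
    ⇝-trans {X} (g , g∈O , g:X↦Y) (h , h∈O , h:Y↦Z) = h ·m g , InO-·m h∈O g∈O , λ i →
      ≡-mod-trans (≡⇒≡-mod (matVec-matMul (matAt h k) (matAt g k) X i))
        (≡-mod-trans (matVec-congʳ-mod (matAt h k) g:X↦Y i) (h:Y↦Z i))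

    reflection-⇝ : ∀ Y X σ → σ * σ ≡ 1ℤ → Unit (Q (Y +ᵥ σ *ᵥ X)) → Q Y ≡ Q X mod P ^ k → Y ⇝ X
    reflection-⇝ Y X σ σ*σ≡1 Qv-unit QY≡QX =
      R , R∈O , R-sends k Y X σ σ*σ≡1 -σ*σ≡-1 (λ _ → refl) QY≡QX
      where
        c = proj₁ (Unit⇒invertible Qv-unit)
        negate² : ∀ σ → - σ * - σ ≡ σ * σ
        negate² = solve-∀
        -σ*σ≡-1 : - σ * σ ≡ -1ℤ
        -σ*σ≡-1 = trans (sym (ℤ.neg-distribˡ-* σ σ)) (cong -_ σ*σ≡1)
        open ReflectionMatrix p A A-sym (Y +ᵥ σ *ᵥ X) c (proj₂ (Unit⇒invertible Qv-unit))
                              (- σ) (trans (negate² σ) σ*σ≡1)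

    Q-unit-⇝ : ∀ {U} → Unit (Q U) → ∀ x → Q x ≡ Q U mod P ^ k → U ⇝ x
    Q-unit-⇝ {U} QU-unit x Qx≡QU with P ∣? Q (U +ᵥ -1ℤ *ᵥ x) | P ∣? Q (U +ᵥ 1ℤ *ᵥ x)
    ... | no Qv₋-unit | _           = reflection-⇝ U x -1ℤ refl Qv₋-unit (≡-mod-sym Qx≡QU)
    ... | yes _       | no Qv₊-unit = reflection-⇝ U x 1ℤ refl Qv₊-unit (≡-mod-sym Qx≡QU)
    ... | yes P∣Qv₋   | yes P∣Qv₊   =
      contradiction (∣m∣n⇒∣m+n P∣Qv₊ P∣Qv₋) (Unit-resp-≡-mod (mod-P 4QU≡Qv₊+Qv₋) 4QU-unit)
      where
        open ≡-mod-Reasoning (P ^ k)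
        4QU-unit : Unit ((+ 2 * + 2) * Q U)
        4QU-unit = Unit-* (Unit-* Unit-2 Unit-2) QU-unit
        parallelogram : ∀ a b c → (a + (+ 2 * 1ℤ) * b + (1ℤ * 1ℤ) * c) + (a + (+ 2 * -1ℤ) * b + (-1ℤ * -1ℤ) * c)
                                  ≡ (+ 2 * + 2) * a + + 2 * (c - a)
        parallelogram = solve-∀
        4QU≡Qv₊+Qv₋ : (+ 2 * + 2) * Q U ≡ Q (U +ᵥ 1ℤ *ᵥ x) + Q (U +ᵥ -1ℤ *ᵥ x) mod P ^ k
        4QU≡Qv₊+Qv₋ = begin
          (+ 2 * + 2) * Q U                            ≡⟨ ℤ.+-identityʳ _ ⟨
          (+ 2 * + 2) * Q U + 0ℤ                       ≡⟨ cong (_+_ ((+ 2 * + 2) * Q U)) (ℤ.*-zeroʳ (+ 2)) ⟨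
          (+ 2 * + 2) * Q U + + 2 * 0ℤ                 ≈⟨ +-congˡ-mod ((+ 2 * + 2) * Q U) (*-congˡ-mod (+ 2) (≡-mod-sym (∣⇒≡0-mod (∣-diff Qx≡QU)))) ⟩
          (+ 2 * + 2) * Q U + + 2 * (Q x - Q U)        ≡⟨ parallelogram (Q U) (B U x) (Q x) ⟨
          (Q U + (+ 2 * 1ℤ) * B U x + (1ℤ * 1ℤ) * Q x) + (Q U + (+ 2 * -1ℤ) * B U x + (-1ℤ * -1ℤ) * Q x)
                                                       ≡⟨ cong₂ _+_ (Q-expand U 1ℤ x) (Q-expand U -1ℤ x) ⟨
          Q (U +ᵥ 1ℤ *ᵥ x) + Q (U +ᵥ -1ℤ *ᵥ x)         ∎

    B-basis : ∀ Y i → B Y (λ t → Id i t 0) ≡ matVec A Y i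
    B-basis Y i = begin
      B Y (λ t → Id i t 0)                                ≡⟨ B-sym Y _ ⟩
      B (λ t → Id i t 0) Y                                ≡⟨ bil≡Σ*matVec A (λ t → Id i t 0) Y ⟩
      matVec (matAt Id 0) (matVec A Y) i                  ≡⟨ matVec-Id 0 (matVec A Y) i ⟩
      matVec A Y i                                        ∎
      where open ≡-Reasoning

    nondegenerate : Unit (det A) → ∀ Y → ¬ (∀ i → P ∣ Y i) → Σ (Vector ℤ n) λ e → Unit (B Y e)
    nondegenerate det-unit Y Y-primitive with Fin.all? (λ i → P ∣? matVec A Y i)
    ... | no ¬P∣AY with Fin.¬∀⟶∃¬ n _ (λ i → P ∣? matVec A Y i) ¬P∣AY
    ...   | i , AYᵢ-unit = (λ t → Id i t 0) , AYᵢ-unit ∘ subst (P ∣_) (B-basis Y i)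
    nondegenerate det-unit Y Y-primitive | yes P∣AY with Fin.¬∀⟶∃¬ n _ (λ i → P ∣? Y i) Y-primitive
    ...   | l , Yₗ-unit with prime-divides-product (Y l) (det A) (∣-matVec⇒∣-det A Y P∣AY l)
    ...     | inj₁ P∣Yₗ   = contradiction P∣Yₗ Yₗ-unit
    ...     | inj₂ P∣detA = contradiction P∣detA det-unit

    -- One of t = 0, 1, 2 works; t = 2 needs p ≠ 2.
    unit-on-both : ∀ a₁ b₁ a₂ b₂ → Unit a₁ → Unit b₂ → Σ ℤ λ t → Unit (a₁ + t * b₁) × Unit (a₂ + t * b₂)
    unit-on-both a₁ b₁ a₂ b₂ a₁-unit b₂-unit with P ∣? a₂
    ... | no a₂-unit = 0ℤ , subst Unit (shift-0 a₁ b₁) a₁-unit , subst Unit (shift-0 a₂ b₂) a₂-unit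
      where
        shift-0 : ∀ a b → a ≡ a + 0ℤ * b
        shift-0 = solve-∀
    ... | yes P∣a₂ with P ∣? a₁ + 1ℤ * b₁
    ...   | no a₁+b₁-unit = 1ℤ , a₁+b₁-unit , Unit-resp-≡-mod b₂≡a₂+b₂ b₂-unit
      where
        b₂≡a₂+b₂ : b₂ ≡ a₂ + 1ℤ * b₂ mod P
        b₂≡a₂+b₂ = begin
          b₂            ≡⟨ ℤ.*-identityˡ b₂ ⟨
          1ℤ * b₂       ≡⟨ ℤ.+-identityˡ _ ⟨
          0ℤ + 1ℤ * b₂  ≈⟨ +-cong-mod (≡-mod-sym (∣⇒≡0-mod P∣a₂)) ≡-mod-refl ⟩
          a₂ + 1ℤ * b₂  ∎
          where open ≡-mod-Reasoning P
    ...   | yes P∣a₁+b₁ = + 2 , Unit-resp-≡-mod -a₁≡a₁+2b₁ (Unit-neg a₁-unit) , Unit-resp-≡-mod 2b₂≡a₂+2b₂ (Unit-* Unit-2 b₂-unit)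
      where
        open ≡-mod-Reasoning P
        regroup : ∀ a b → a + + 2 * b ≡ + 2 * (a + 1ℤ * b) + - a
        regroup = solve-∀
        -a₁≡a₁+2b₁ : - a₁ ≡ a₁ + + 2 * b₁ mod P
        -a₁≡a₁+2b₁ = begin
          - a₁                            ≡⟨ ℤ.+-identityˡ (- a₁) ⟨
          0ℤ + - a₁                       ≡⟨ cong (_+ - a₁) (ℤ.*-zeroʳ (+ 2)) ⟨
          + 2 * 0ℤ + - a₁                 ≈⟨ +-cong-mod (*-congˡ-mod (+ 2) (≡-mod-sym (∣⇒≡0-mod P∣a₁+b₁))) ≡-mod-refl ⟩
          + 2 * (a₁ + 1ℤ * b₁) + - a₁     ≡⟨ regroup a₁ b₁ ⟨
          a₁ + + 2 * b₁                   ∎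
        2b₂≡a₂+2b₂ : + 2 * b₂ ≡ a₂ + + 2 * b₂ mod P
        2b₂≡a₂+2b₂ = begin
          + 2 * b₂       ≡⟨ ℤ.+-identityˡ _ ⟨
          0ℤ + + 2 * b₂  ≈⟨ +-cong-mod (≡-mod-sym (∣⇒≡0-mod P∣a₂)) ≡-mod-refl ⟩
          a₂ + + 2 * b₂  ∎

    common-nonorthogonal : ∀ U x {e f} → Unit (B U e) → Unit (B x f) →
                           Σ (Vector ℤ n) λ z → Unit (B U z) × Unit (B x z)
    common-nonorthogonal U x {e} {f} BUe-unit Bxf-unit
      with unit-on-both (B U e) (B U f) (B x e) (B x f) BUe-unit Bxf-unit
    ... | t , BUz-unit , Bxz-unit =
      e +ᵥ t *ᵥ f , subst Unit (sym (B-linearʳ U e t f)) BUz-unit , subst Unit (sym (B-linearʳ x e t f)) Bxz-unit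

    isotropic-sum : ∀ {Y X} → P ∣ Q Y → P ∣ Q X → Unit (B Y X) → Unit (Q (Y +ᵥ 1ℤ *ᵥ X))
    isotropic-sum {Y} {X} P∣QY P∣QX BYX-unit = Unit-resp-≡-mod 2B≡Q (Unit-* Unit-2 BYX-unit)
      where
        open ≡-mod-Reasoning P
        regroup : ∀ b → + 2 * b ≡ 0ℤ + (+ 2 * 1ℤ) * b + (1ℤ * 1ℤ) * 0ℤ
        regroup = solve-∀
        2B≡Q : + 2 * B Y X ≡ Q (Y +ᵥ 1ℤ *ᵥ X) mod P
        2B≡Q = begin
          + 2 * B Y X                                      ≡⟨ regroup (B Y X) ⟩
          0ℤ + (+ 2 * 1ℤ) * B Y X + (1ℤ * 1ℤ) * 0ℤ         ≈⟨ +-cong-mod (+-cong-mod (≡-mod-sym (∣⇒≡0-mod P∣QY)) ≡-mod-refl)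
                                                                (*-congˡ-mod (1ℤ * 1ℤ) (≡-mod-sym (∣⇒≡0-mod P∣QX))) ⟩
          Q Y + (+ 2 * 1ℤ) * B Y X + (1ℤ * 1ℤ) * Q X       ≡⟨ Q-expand Y 1ℤ X ⟨
          Q (Y +ᵥ 1ℤ *ᵥ X)                                 ∎

    B-shift : ∀ {Y U} z → P ∣ B Y U → B Y z ≡ B Y (z +ᵥ 1ℤ *ᵥ U) mod P
    B-shift {Y} {U} z P∣BYU = begin
      B Y z                     ≡⟨ ℤ.+-identityʳ (B Y z) ⟨
      B Y z + 0ℤ                ≡⟨ cong (_+_ (B Y z)) (ℤ.*-zeroʳ 1ℤ) ⟨
      B Y z + 1ℤ * 0ℤ           ≈⟨ +-congˡ-mod (B Y z) (*-congˡ-mod 1ℤ (≡-mod-sym (∣⇒≡0-mod P∣BYU))) ⟩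
      B Y z + 1ℤ * B Y U        ≡⟨ B-linearʳ Y z 1ℤ U ⟨
      B Y (z +ᵥ 1ℤ *ᵥ U)        ∎
      where open ≡-mod-Reasoning P

    anisotropic-nonorthogonal : ∀ {U x z} → P ∣ Q U → P ∣ B x U → Unit (B U z) → Unit (B x z) →
      Σ (Vector ℤ n) λ w → Unit (Q w) × Unit (B U w) × Unit (B x w)
    anisotropic-nonorthogonal {U} {x} {z} P∣QU P∣BxU BUz-unit Bxz-unit with P ∣? Q z
    ... | no Qz-unit = z , Qz-unit , BUz-unit , Bxz-unit
    ... | yes P∣Qz   = z +ᵥ 1ℤ *ᵥ U
      , isotropic-sum P∣Qz P∣QU (subst Unit (B-sym U z) BUz-unit)
      , Unit-resp-≡-mod (B-shift z P∣QU) BUz-unit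
      , Unit-resp-≡-mod (B-shift z P∣BxU) Bxz-unit

    -- The reflection in w⊥ sends U to y with Q y ≡ Q U and B(x, y) a unit, so y + x is
    -- anisotropic and a second reflection sends y to x.
    two-reflections-⇝ : ∀ {U x} → P ∣ Q U → P ∣ B x U → Q x ≡ Q U mod P ^ k →
      ∀ w → Unit (Q w) → Unit (B U w) → Unit (B x w) → U ⇝ x
    two-reflections-⇝ {U} {x} P∣QU P∣BxU Qx≡QU w Qw-unit BUw-unit Bxw-unit =
      ⇝-trans (R , R∈O , λ _ → ≡-mod-refl) (reflection-⇝ y x 1ℤ refl Q[y+x]-unit Qy≡Qx)
      where
        c = proj₁ (Unit⇒invertible Qw-unit)
        Qw·c≡1 = proj₂ (Unit⇒invertible Qw-unit)
        open ReflectionMatrix p A A-sym w c Qw·c≡1 1ℤ refl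
        open NewtonInverse p (Q w) c Qw·c≡1
        C = inverse k
        t = - (+ 2 * C * B U w)
        y = matVec (matAt R k) U
        Qy≡Qx : Q y ≡ Q x mod P ^ k
        Qy≡Qx = ≡-mod-trans (R-isometric k U) (≡-mod-sym Qx≡QU)
        P∣Qx : P ∣ Q x
        P∣Qx = ∣-resp-≡-mod (mod-P Qx≡QU) P∣QU
        C-unit : Unit C
        C-unit P∣C = Unit-1 (∣-resp-≡-mod (≡-mod-sym (mod-P (inverse-≡-mod k))) (∣n⇒∣m*n (Q w) P∣C))
        t-unit : Unit t
        t-unit = Unit-neg (Unit-* (Unit-* Unit-2 C-unit) BUw-unit)
        Bxy≡t·Bxw : B x y ≡ t * B x w mod P
        Bxy≡t·Bxw = begin
          B x y                     ≡⟨ bil-cong A (λ _ → refl) (λ i → trans (R-matVec k U i) (ℤ.*-identityˡ _)) ⟩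
          B x (U +ᵥ t *ᵥ w)         ≡⟨ B-linearʳ x U t w ⟩
          B x U + t * B x w         ≈⟨ +-cong-mod (∣⇒≡0-mod P∣BxU) ≡-mod-refl ⟩
          0ℤ + t * B x w            ≡⟨ ℤ.+-identityˡ _ ⟩
          t * B x w                 ∎
          where open ≡-mod-Reasoning P
        Q[y+x]-unit : Unit (Q (y +ᵥ 1ℤ *ᵥ x))
        Q[y+x]-unit = isotropic-sum (∣-resp-≡-mod (mod-P Qy≡Qx) P∣Qx) P∣Qx
          (subst Unit (B-sym x y) (Unit-resp-≡-mod (≡-mod-sym Bxy≡t·Bxw) (Unit-* t-unit Bxw-unit)))

    det-unit-⇝ : ∀ {U} → Unit (det A) → P ∣ Q U → ¬ (∀ i → P ∣ U i) →
                 ∀ x → ¬ (∀ i → P ∣ x i) → Q x ≡ Q U mod P ^ k → U ⇝ x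
    det-unit-⇝ {U} det-unit P∣QU U-primitive x x-primitive Qx≡QU with P ∣? B U x
    ... | no BUx-unit = reflection-⇝ U x 1ℤ refl (isotropic-sum P∣QU P∣Qx BUx-unit) (≡-mod-sym Qx≡QU)
      where
        P∣Qx = ∣-resp-≡-mod (mod-P Qx≡QU) P∣QU
    ... | yes P∣BUx =
      let P∣BxU = subst (P ∣_) (B-sym U x) P∣BUx
          _ , BUz-unit , Bxz-unit = common-nonorthogonal U x (proj₂ (nondegenerate det-unit U U-primitive))
                                                             (proj₂ (nondegenerate det-unit x x-primitive))
          w , Qw-unit , BUw-unit , Bxw-unit = anisotropic-nonorthogonal P∣QU P∣BxU BUz-unit Bxz-unit
      in two-reflections-⇝ P∣QU P∣BxU Qx≡QU w Qw-unit BUw-unit Bxw-unit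

    ⇝-IndexAtLeast : ∀ (u : Vp n) N (xs : Fin N → Vector ℤ n) → (∀ a → vecAt u k ⇝ xs a) →
                     (∀ a b → a ≢ b → ¬ Sim k (xs a) (xs b)) → IndexAtLeast A k u N
    ⇝-IndexAtLeast u N xs u⇝xs distinct = g , g∈O , λ a b a≢b same-coset →
      distinct a b a≢b (λ i → ≡-mod⇒∣ᵤ (begin
        xs a i                         ≈⟨ proj₂ (proj₂ (u⇝xs a)) i ⟨
        (g a ·v u) i k                 ≈⟨ same-coset⇒≡-mod k u {h = g b} (g∈O a) same-coset i ⟩
        (g b ·v u) i k                 ≈⟨ proj₂ (proj₂ (u⇝xs b)) i ⟩
        xs b i                         ∎))
      where
        open ≡-mod-Reasoning (P ^ k)
        g = λ a → proj₁ (u⇝xs a)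
        g∈O = λ a → proj₁ (proj₂ (u⇝xs a))

  module Orbit (p : ℕ) (p-prime : Prime p) (p≢2 : p ≢ 2) {n} (A : Mat n) (A-sym : Symmetric A)
               (k : ℕ) (1≤k : 1 ℕ.≤ k) (u : PAdic.Vp p n) (u∈L : PAdic.IsZpVec p u) where

    open PAdic p
    open ℤₚ p
    open OddPrime p p-prime p≢2 using (Unit; Unit-resp-≡-mod)
    open Transitivity p p-prime p≢2 A A-sym k 1≤k
    open BilinearForm A A-sym using (Q)

    private
      U = vecAt u k

    Q[u]≡pʲε : ∀ j ε → Qp A u ≈ (ι (P ^ j) ⊗ ε) → Q U ≡ P ^ j ℤ.* ε k mod P
    Q[u]≡pʲε j ε Qu≈pʲε = mod-P (∣ᵤ⇒≡-mod (Qu≈pʲε k))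

    Q[u]-unit : ∀ ε → IsZp ε → IsUnit ε → Qp A u ≈ (ι (P ^ 0) ⊗ ε) → Unit (Q U)
    Q[u]-unit ε ε∈ℤₚ ε-unit Qu≈ε = Unit-resp-≡-mod (≡-mod-sym QU≡ε₁) (ε-unit ∘ ∣⇒∣ᵤ)
      where
        QU≡ε₁ : Q U ≡ ε 1 mod P
        QU≡ε₁ = ≡-mod-trans (Q[u]≡pʲε 0 ε Qu≈ε)
          (≡-mod-trans (≡⇒≡-mod (ℤ.*-identityˡ (ε k))) (IsZp-≡-mod-P ε ε∈ℤₚ 1≤k))

    P∣Q[u] : ∀ j ε → 1 ℕ.≤ j → Qp A u ≈ (ι (P ^ j) ⊗ ε) → P ∣ Q U
    P∣Q[u] j ε 1≤j Qu≈pʲε = ∣-resp-≡-mod (Q[u]≡pʲε j ε Qu≈pʲε) (∣m⇒∣m*n (ε k) (P∣P^m 1≤j))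

    primitive-at-k : Primitive u → ¬ (∀ i → P ∣ U i)
    primitive-at-k u-primitive P∣U = u-primitive λ i →
      ∣⇒∣ᵤ (∣-resp-≡-mod (≡-mod-sym (IsZp-≡-mod-P (u i) (u∈L i) 1≤k)) (P∣U i))

    orbit : ∀ j ε → IsZp ε → IsUnit ε → Qp A u ≈ (ι (P ^ j) ⊗ ε) → Primitive u →
            j ≡ 0 ⊎ (¬ (P Unsigned.∣ det A) × 1 ℕ.≤ j) →
            ∀ x → Primitive (ιv x) → Q x ≡ Q U mod P ^ k → U ⇝ x
    orbit .0 ε ε∈ℤₚ ε-unit Qu≈ε _ (inj₁ refl) x _ Qx≡QU =
      Q-unit-⇝ (Q[u]-unit ε ε∈ℤₚ ε-unit Qu≈ε) x Qx≡QU
    orbit j ε _ _ Qu≈pʲε u-primitive (inj₂ (det-unit , 1≤j)) x x-primitive Qx≡QU =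
      det-unit-⇝ (det-unit ∘ ∣⇒∣ᵤ) (P∣Q[u] j ε 1≤j Qu≈pʲε) (primitive-at-k u-primitive)
                 x (λ P∣x → x-primitive (∣⇒∣ᵤ ∘ P∣x)) Qx≡QU

    InR-lower : ∀ {j x} → InR A u (k ℕ.+ j) x → Q x ≡ Q U mod P ^ k
    InR-lower {j} (_ , Qx≡Qu) = ≡-mod-trans
      (≡-mod-weaken (subst (λ l → P ^ k ∣ P ^ l) (ℕ.+-comm j k) (P^m∣P^[k+m] j k)) (∣ᵤ⇒≡-mod Qx≡Qu))
      (bil-cong-mod A (λ i → IsZp-≤ (u i) (u∈L i) (ℕ.m≤m+n k j)))

open import Data.Nat using (ℕ; _+_; _≤_)
open import Data.Nat.Primality using (Prime)
open import Data.Integer using (ℤ; _^_; +_)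
open import Data.Integer.Divisibility using (_∣_)
open import Data.Fin using (Fin)
open import Data.Product using (Σ; _×_)
open import Data.Sum using (_⊎_)
open import Relation.Nullary using (¬_)
open import Relation.Binary.PropositionalEquality using (_≡_; _≢_)
open import Data.Product using (_,_; proj₁; proj₂)

lemma5p2 : (n : ℕ) (A : Mat n) → Symmetric A → Regular A →
    (p : ℕ) → Prime p → p ≢ 2 →
    (k j : ℕ) → 1 ≤ k →
    (u : PAdic.Vp p n) → PAdic.IsZpVec p u → PAdic.Primitive p u →
    Σ (PAdic.Seq p) (λ ε → PAdic.IsZp p ε × PAdic.IsUnit p ε ×
      PAdic._≈_ p (PAdic.Qp p A u) (PAdic._⊗_ p (PAdic.ι p ((+ p) ^ j)) ε)) →
    (j ≡ 0 ⊎ (¬ (+ p ∣ det A) × 1 ≤ j)) →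
    (∀ (N : ℕ) (xs : Fin N → Fin n → ℤ) →
      (∀ a → PAdic.InR p A u (k + j) (xs a)) →
      (∀ a b → a ≢ b → ¬ PAdic.Sim p k (xs a) (xs b)) →
      PAdic.IndexAtLeast p A k u N)
    × (∀ (N : ℕ) (xs : Fin N → Fin n → ℤ) →
      (∀ a → PAdic.InR p A u k (xs a)) →
      (∀ a b → a ≢ b → ¬ PAdic.Sim p k (xs a) (xs b)) →
      PAdic.IndexAtLeast p A k u N)
lemma5p2 n A A-sym _ p p-prime p≢2 k j 1≤k u u∈L u-primitive (ε , ε∈ℤₚ , ε-unit , Qu≈pʲε) cases =
    (λ N xs xs∈R → ⇝-IndexAtLeast u N xs (λ a → reach (xs a) (proj₁ (xs∈R a)) (InR-lower (xs∈R a))))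
  , (λ N xs xs∈R → ⇝-IndexAtLeast u N xs (λ a → reach (xs a) (proj₁ (xs∈R a)) (∣ᵤ⇒≡-mod (proj₂ (xs∈R a)))))
  where
    open Transitivity p p-prime p≢2 A A-sym k 1≤k using (⇝-IndexAtLeast)
    open Orbit p p-prime p≢2 A A-sym k 1≤k u u∈L
    reach = orbit j ε ε∈ℤₚ ε-unit Qu≈pʲε u-primitive cases
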